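{- Let $m\ge 2$ and $n\ge 3$. Then: $\mathrm{f}\mu^{k}(P_m\,\square\,C_n)=3$ if $k\ge 1$ and $n=3$; $\mathrm{f}\mu^{k}(P_m\,\square\,C_n)=\min\{2m,n\}$ if $k=1$ and $n\ge 4$ is even; $\mathrm{f}\mu^{k}(P_m\,\square\,C_n)=\max\{3,\min\{m,n\}\}$ if $k=1$ and $n\ge 5$ is odd; $\mathrm{f}\mu^{k}(P_m\,\square\,C_n)=2$ if $k\ge 2$ and $n\ge 4$.
   Context: For an integer $k\ge 0$ and a connected graph $G$, a set $X\subseteq V(G)$ is a $k$-fault-tolerant mutual-visibility set ($k$-ftmv set) if for any two non-adjacent vertices $u,v\in X$ there exist $k+1$ internally vertex-disjoint shortest $u,v$-paths $Q_1,\dots,Q_{k+1}$ in $G$ such that $V(Q_i)\cap X=\{u,v\}$ for every $i$. $\mathrm{f}\mu^{k}(G)$ denotes the maximum cardinality of a $k$-ftmv set of $G$. $P_m$ is the path on $m$ vertices, $C_n$ the cycle on $n$ vertices, and $G\,\square\,H$ is the Cartesian product: vertex set $V(G)\times V(H)$, with $(g,h)\sim(g',h')$ iff either $g=g'$ and $hh'\in E(H)$, or $gg'\in E(G)$ and $h=h'$. -}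

module Defs where

open import Level using (0ℓ)
open import Data.Nat using (ℕ; zero; suc; _≤_)
open import Data.Fin using (Fin; toℕ)
open import Data.Product using (Σ; _×_; _,_)
open import Data.Sum using (_⊎_)
open import Data.List using (List; []; _∷_; length)
open import Data.List.Membership.Propositional using (_∈_; _∉_)
open import Data.List.Relation.Unary.Unique.Propositional using (Unique)
open import Relation.Binary.PropositionalEquality using (_≡_; _≢_)
open import Relation.Nullary using (¬_)

record Graph : Set₁ where
  field
    V   : Set
    Adj : V → V → Set

module _ (G : Graph) where
  open Graph G

  data Walk : V → V → ℕ → Set where
    []  : ∀ {u} → Walk u u 0
    _∷_ : ∀ {u w v ℓ} → Adj u w → Walk w v ℓ → Walk u v (suc ℓ)

  inner : ∀ {u v ℓ} → Walk u v ℓ → List V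
  inner [] = []
  inner (a ∷ []) = []
  inner (_∷_ {w = w} a (b ∷ p)) = w ∷ inner (b ∷ p)

  IsShortest : ∀ {u v ℓ} → Walk u v ℓ → Set
  IsShortest {u} {v} {ℓ} _ = ∀ ℓ' → Walk u v ℓ' → ℓ ≤ ℓ'

  record ShortestPath (u v : V) : Set where
    constructor sp
    field
      len      : ℕ
      walk     : Walk u v len
      shortest : IsShortest walk

  innerSP : ∀ {u v} → ShortestPath u v → List V
  innerSP p = inner (ShortestPath.walk p)

  -- k-fault-tolerant mutual-visibility set (X given as a list of distinct vertices).
  IsFTMV : ℕ → List V → Set
  IsFTMV k X =
    ∀ u v → u ∈ X → v ∈ X → u ≢ v → ¬ Adj u v →
      Σ (Fin (suc k) → ShortestPath u v) λ Q →
        (∀ i j → i ≢ j → ∀ x → x ∈ innerSP (Q i) → x ∉ innerSP (Q j))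
        × (∀ i x → x ∈ innerSP (Q i) → x ∉ X)

  IsFμ : ℕ → ℕ → Set
  IsFμ k N =
    (Σ (List V) λ X → Unique X × IsFTMV k X × length X ≡ N)
    × (∀ X → Unique X → IsFTMV k X → length X ≤ N)

PathAdj : ∀ m → Fin m → Fin m → Set
PathAdj m i j = suc (toℕ i) ≡ toℕ j ⊎ suc (toℕ j) ≡ toℕ i

CycleAdj : ∀ n → Fin n → Fin n → Set
CycleAdj n i j =
  suc (toℕ i) ≡ toℕ j ⊎ suc (toℕ j) ≡ toℕ i
  ⊎ (toℕ i ≡ 0 × suc (toℕ j) ≡ n) ⊎ (toℕ j ≡ 0 × suc (toℕ i) ≡ n)

PmCn : ℕ → ℕ → Graph
PmCn m n = record
  { V   = Fin m × Fin n
  ; Adj = λ { (g , h) (g' , h') →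
              (g ≡ g' × CycleAdj n h h') ⊎ (PathAdj m g g' × h ≡ h') } }

{-# OPTIONS --safe #-}
module Submission where

-- In P_m □ C_n the distance is |Δrow| plus the cyclic distance of the columns, so the second vertex
-- of a geodesic from u towards v is either the unique vertical step or one of at most two horizontal
-- steps, and two horizontal steps both shorten the distance only when col u and col v are antipodal.
-- In a 1-ftmv set X every non-adjacent pair u, v has two disjoint geodesics whose second vertices lie
-- outside X. Hence vertices of X in a common row have antipodal columns, vertices in a common column
-- are adjacent, and any further vertex of X that is a step from u towards v forces antipodal columns.
-- For odd n there are no antipodes: beyond three vertices both the row and the column of a vertex of
-- X are injective, giving max{3, min{m, n}}. For even n the columns are injective and the row together
-- with the half of C_n containing the column is injective, giving min{2m, n}. For k ≥ 2 three disjoint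
-- geodesics force every non-adjacent pair of X to be at distance ≥ 3 with antipodal columns, which
-- leaves no room for a third vertex when n ≥ 4. The matching sets are a diagonal, the pairs
-- (i, i), (i, i + n/2), an edge of the top row with the opposite vertex of the bottom row (m = 2),
-- a row edge, and a row triangle of C_3.

open import Defs
open import Data.Nat
open import Data.Nat.Properties
open import Data.Nat.Divisibility using (_∣_; divides)
open import Data.Nat.Tactic.RingSolver using (solve-∀)
open import Data.Fin using (Fin; toℕ; fromℕ<) renaming (zero to fzero; suc to fsuc; _≟_ to _≟ᶠ_)
open import Data.Fin.Properties using (toℕ<n; toℕ-injective; toℕ-fromℕ<)
open import Data.Product using (Σ; _×_; _,_; proj₁; proj₂)
open import Data.Product.Properties using (×-≡,≡→≡; ≡-dec)
open import Data.Sum using (_⊎_; inj₁; inj₂; [_,_]′)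
import Data.Sum as Sum
open import Data.Empty using (⊥; ⊥-elim)
open import Data.List using (List; []; _∷_; length; map; upTo)
open import Data.List.Properties using (length-map; length-upTo; length-removeAt′)
open import Data.List.Membership.Propositional using (_∈_; _∉_; _─_; find; lose)
open import Data.List.Membership.Propositional.Properties using (∈-upTo⁺; ∈-map⁻)
open import Data.List.Relation.Unary.Any using (here; there; any?)
open import Data.List.Relation.Unary.All using (All; []; _∷_; lookup)
import Data.List.Relation.Unary.All as All
open import Data.List.Relation.Unary.All.Properties using (¬Any⇒All¬)
open import Data.List.Relation.Unary.Unique.Propositional using (Unique; []; _∷_)
open import Function using (id; _∘_; case_of_)
open import Relation.Binary.PropositionalEquality
open import Relation.Binary.Definitions using (DecidableEquality)
open import Relation.Nullary using (¬_; Dec; yes; no; ¬?)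
open import Relation.Nullary.Decidable using (_×-dec_; _⊎-dec_)

-- Arithmetic

m∸n≤1+m∸[1+n] : ∀ m n → m ∸ n ≤ suc (m ∸ suc n)
m∸n≤1+m∸[1+n] zero zero = z≤n
m∸n≤1+m∸[1+n] zero (suc n) = z≤n
m∸n≤1+m∸[1+n] (suc m) zero = ≤-refl
m∸n≤1+m∸[1+n] (suc m) (suc n) = m∸n≤1+m∸[1+n] m n

1+m≡n⇒n∸m≡1 : ∀ {m n} → suc m ≡ n → n ∸ m ≡ 1
1+m≡n⇒n∸m≡1 {m} refl = trans (cong (_∸ m) (+-comm 1 m)) (m+n∸m≡n m 1)

∣1+a-e∣-cases : ∀ a e → (∣ suc a - e ∣ ≡ suc ∣ a - e ∣ × e ≤ a) ⊎ (∣ a - e ∣ ≡ suc ∣ suc a - e ∣ × a < e)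
∣1+a-e∣-cases zero zero = inj₁ (refl , z≤n)
∣1+a-e∣-cases (suc a) zero = inj₁ (refl , z≤n)
∣1+a-e∣-cases zero (suc e) = inj₂ (refl , s≤s z≤n)
∣1+a-e∣-cases (suc a) (suc e) with ∣1+a-e∣-cases a e
... | inj₁ (p , q) = inj₁ (p , s≤s q)
... | inj₂ (p , q) = inj₂ (p , s≤s q)

∣1+a-e∣≤1+∣a-e∣ : ∀ a e → ∣ suc a - e ∣ ≤ suc ∣ a - e ∣
∣1+a-e∣≤1+∣a-e∣ a e with ∣1+a-e∣-cases a e
... | inj₁ (p , _) = ≤-reflexive p
... | inj₂ (p , _) = ≤-trans (n≤1+n _) (≤-trans (≤-reflexive (sym p)) (n≤1+n _))

∣a-e∣≤1+∣1+a-e∣ : ∀ a e → ∣ a - e ∣ ≤ suc ∣ suc a - e ∣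
∣a-e∣≤1+∣1+a-e∣ a e with ∣1+a-e∣-cases a e
... | inj₁ (p , _) = ≤-trans (n≤1+n _) (≤-trans (≤-reflexive (sym p)) (n≤1+n _))
... | inj₂ (p , _) = ≤-reflexive p

Consecutive : ℕ → ℕ → Set
Consecutive a b = b ≡ suc a ⊎ suc b ≡ a

consecutive-irrefl : ∀ {a} → ¬ Consecutive a a
consecutive-irrefl (inj₁ eq) = 1+n≢n (sym eq)
consecutive-irrefl (inj₂ eq) = 1+n≢n eq

consecutive-sym : ∀ {a b} → Consecutive a b → Consecutive b a
consecutive-sym (inj₁ eq) = inj₂ (sym eq)
consecutive-sym (inj₂ eq) = inj₁ (sym eq)

no-consecutive-triangle : ∀ {a b c} → Consecutive a b → Consecutive b c → ¬ Consecutive a c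
no-consecutive-triangle (inj₁ refl) (inj₁ refl) (inj₁ eq) = 1+n≢n eq
no-consecutive-triangle {a} (inj₁ refl) (inj₁ refl) (inj₂ eq) = <⇒≢ (≤-trans (n<1+n a) (≤-trans (n≤1+n _) (n≤1+n _))) (sym eq)
no-consecutive-triangle {a} (inj₁ refl) (inj₂ eq) ac = consecutive-irrefl (subst (Consecutive a) (suc-injective eq) ac)
no-consecutive-triangle (inj₂ refl) (inj₁ refl) ac = consecutive-irrefl ac
no-consecutive-triangle (inj₂ refl) (inj₂ refl) (inj₁ eq) = <⇒≢ (≤-trans (n<1+n _) (≤-trans (n≤1+n _) (n≤1+n _))) eq
no-consecutive-triangle (inj₂ refl) (inj₂ refl) (inj₂ eq) = 1+n≢n (sym (suc-injective eq))

consecutive⇒∣-∣-distinct : ∀ {a b} → Consecutive a b → ∀ e → ∣ b - e ∣ < ∣ a - e ∣ ⊎ ∣ a - e ∣ < ∣ b - e ∣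
consecutive⇒∣-∣-distinct {a} (inj₁ refl) e with ∣1+a-e∣-cases a e
... | inj₁ (p , _) = inj₂ (subst (∣ a - e ∣ <_) (sym p) (n<1+n _))
... | inj₂ (p , _) = inj₁ (subst (∣ suc a - e ∣ <_) (sym p) (n<1+n _))
consecutive⇒∣-∣-distinct {b = b} (inj₂ refl) e with ∣1+a-e∣-cases b e
... | inj₁ (p , _) = inj₁ (subst (∣ b - e ∣ <_) (sym p) (n<1+n _))
... | inj₂ (p , _) = inj₂ (subst (∣ suc b - e ∣ <_) (sym p) (n<1+n _))

consecutive-closer : ∀ {a x} e → Consecutive a x → ∣ x - e ∣ < ∣ a - e ∣ → (x ≡ suc a × a < e) ⊎ (suc x ≡ a × e < a)
consecutive-closer {a} e (inj₁ refl) closer with ∣1+a-e∣-cases a e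
... | inj₁ (p , _) = ⊥-elim (<-asym (subst (_< ∣ a - e ∣) p closer) (n<1+n _))
... | inj₂ (_ , a<e) = inj₁ (refl , a<e)
consecutive-closer {x = x} e (inj₂ refl) closer with ∣1+a-e∣-cases x e
... | inj₁ (_ , e≤x) = inj₂ (refl , s≤s e≤x)
... | inj₂ (p , _) = ⊥-elim (<-asym closer (subst (∣ suc x - e ∣ <_) (sym p) (n<1+n _)))

block-+-injective : ∀ {m a b r s} → (a ≡ 0 ⊎ a ≡ m) → (b ≡ 0 ⊎ b ≡ m) → r < m → s < m → a + r ≡ b + s → a ≡ b × r ≡ s
block-+-injective (inj₁ refl) (inj₁ refl) _ _ eq = refl , eq
block-+-injective {m} (inj₂ refl) (inj₂ refl) _ _ eq = refl , +-cancelˡ-≡ m _ _ eq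
block-+-injective {m} {s = s} (inj₁ refl) (inj₂ refl) r<m _ eq = ⊥-elim (<⇒≱ r<m (subst (m ≤_) (sym eq) (m≤m+n m s)))
block-+-injective {m} {r = r} (inj₂ refl) (inj₁ refl) _ s<m eq = ⊥-elim (<⇒≱ s<m (subst (m ≤_) eq (m≤m+n m r)))

+-double-injective : ∀ {t s} → t + t ≡ s + s → t ≡ s
+-double-injective {t} {s} eq = trans (n≡⌊n+n/2⌋ t) (trans (cong ⌊_/2⌋ eq) (sym (n≡⌊n+n/2⌋ s)))

double≢odd : ∀ t s → t + t ≢ suc (s + s)
double≢odd t s eq = even≢odd t s (trans (cong (t +_) (+-identityʳ t)) (trans eq (cong (λ z → suc (s + z)) (sym (+-identityʳ s)))))

even⊎odd : ∀ n → Σ ℕ (λ h → n ≡ h + h) ⊎ Σ ℕ (λ h → n ≡ suc (h + h))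
even⊎odd zero = inj₁ (0 , refl)
even⊎odd (suc zero) = inj₂ (0 , refl)
even⊎odd (suc (suc n)) with even⊎odd n
... | inj₁ (h , n≡) = inj₁ (suc h , cong suc (trans (cong suc n≡) (sym (+-suc h h))))
... | inj₂ (h , n≡) = inj₂ (suc h , cong suc (cong suc (trans n≡ (sym (+-suc h h)))))

telescope-+ : ∀ B E F {t₁ t₂ t₃ x₁ x₂ x₃} → B + t₁ ≡ E + x₁ → E + t₂ ≡ F + x₂ → B + t₃ ≡ F + x₃ →
              (t₁ + t₂) + x₃ ≡ t₃ + (x₁ + x₂)
telescope-+ B E F {t₁} {t₂} {t₃} {x₁} {x₂} {x₃} p₁ p₂ p₃ =
  +-cancelˡ-≡ (B + E + F) _ _
    (trans (regroupˡ B E F t₁ t₂ x₃) (trans (cong₂ _+_ (cong₂ _+_ p₁ p₂) (sym p₃)) (regroupʳ B E F t₃ x₁ x₂)))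
  where
  regroupˡ : ∀ B E F t₁ t₂ x₃ → (B + E + F) + ((t₁ + t₂) + x₃) ≡ (B + t₁) + (E + t₂) + (F + x₃)
  regroupˡ = solve-∀
  regroupʳ : ∀ B E F t₃ x₁ x₂ → (E + x₁) + (F + x₂) + (B + t₃) ≡ (B + E + F) + (t₃ + (x₁ + x₂))
  regroupʳ = solve-∀

2∣n⇒even : ∀ {n} → 2 ∣ n → Σ ℕ λ h → n ≡ h + h
2∣n⇒even (divides h n≡h*2) = h , trans n≡h*2 (trans (*-comm h 2) (cong (h +_) (+-identityʳ h)))

¬2∣n⇒odd : ∀ {n} → ¬ (2 ∣ n) → Σ ℕ λ h → n ≡ suc (h + h)
¬2∣n⇒odd {n} 2∤n with even⊎odd n
... | inj₁ (h , n≡2h) = ⊥-elim (2∤n (divides h (trans n≡2h (trans (cong (h +_) (sym (+-identityʳ h))) (*-comm 2 h)))))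
... | inj₂ odd = odd

fromℕ<-≢ : ∀ {a b k} (a<k : a < k) (b<k : b < k) → a ≢ b → fromℕ< a<k ≢ fromℕ< b<k
fromℕ<-≢ a<k b<k a≢b e = a≢b (trans (sym (toℕ-fromℕ< a<k)) (trans (cong toℕ e) (toℕ-fromℕ< b<k)))

-- Counting

two-sides-of-three : ∀ {A : Set} (P Q : A → Set) → (∀ {a b} → a ≢ b → P a → ¬ P b) → (∀ {a b} → a ≢ b → Q a → ¬ Q b) →
                     ∀ {a₁ a₂ a₃} → a₁ ≢ a₂ → a₁ ≢ a₃ → a₂ ≢ a₃ → P a₁ ⊎ Q a₁ → P a₂ ⊎ Q a₂ → ¬ (P a₃ ⊎ Q a₃)
two-sides-of-three P Q P-once Q-once a₁≢a₂ _ _ (inj₁ p₁) (inj₁ p₂) _ = P-once a₁≢a₂ p₁ p₂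
two-sides-of-three P Q P-once Q-once a₁≢a₂ _ _ (inj₂ q₁) (inj₂ q₂) _ = Q-once a₁≢a₂ q₁ q₂
two-sides-of-three P Q P-once Q-once _ a₁≢a₃ _ (inj₁ p₁) (inj₂ _) (inj₁ p₃) = P-once a₁≢a₃ p₁ p₃
two-sides-of-three P Q P-once Q-once _ _ a₂≢a₃ (inj₁ _) (inj₂ q₂) (inj₂ q₃) = Q-once a₂≢a₃ q₂ q₃
two-sides-of-three P Q P-once Q-once _ _ a₂≢a₃ (inj₂ _) (inj₁ p₂) (inj₁ p₃) = P-once a₂≢a₃ p₂ p₃
two-sides-of-three P Q P-once Q-once _ a₁≢a₃ _ (inj₂ q₁) (inj₁ _) (inj₂ q₃) = Q-once a₁≢a₃ q₁ q₃

module _ {A : Set} where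

  ∈-─ : ∀ {x z : A} {ys} (x∈ys : x ∈ ys) → z ∈ ys → z ≢ x → z ∈ ys ─ x∈ys
  ∈-─ (here refl) (here refl) z≢x = ⊥-elim (z≢x refl)
  ∈-─ (here refl) (there z∈ys) _ = z∈ys
  ∈-─ (there x∈ys) (here refl) _ = here refl
  ∈-─ (there x∈ys) (there z∈ys) z≢x = there (∈-─ x∈ys z∈ys z≢x)

  Unique-⊆⇒length≤ : ∀ {xs : List A} → Unique xs → ∀ ys → (∀ {x} → x ∈ xs → x ∈ ys) → length xs ≤ length ys
  Unique-⊆⇒length≤ [] ys xs⊆ys = z≤n
  Unique-⊆⇒length≤ {x ∷ xs} (x∉xs ∷ uxs) ys xs⊆ys =
    subst (suc (length xs) ≤_) (sym (length-removeAt′ ys _))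
      (s≤s (Unique-⊆⇒length≤ uxs (ys ─ x∈ys) λ z∈xs → ∈-─ x∈ys (xs⊆ys (there z∈xs)) (≢-sym (lookup x∉xs z∈xs))))
    where x∈ys = xs⊆ys (here refl)

  module _ (_≟_ : DecidableEquality A) where
    open import Data.List.Membership.DecPropositional _≟_ using (_∈?_)

    ∃-∉-of-longer : ∀ {xs : List A} → Unique xs → (ys : List A) → length ys < length xs →
                    Σ A λ w → w ∈ xs × w ∉ ys
    ∃-∉-of-longer {xs} uxs ys ys<xs with any? (λ x → ¬? (x ∈? ys)) xs
    ... | yes some∉ = find some∉
    ... | no none∉ = ⊥-elim (<⇒≱ ys<xs (Unique-⊆⇒length≤ uxs ys xs⊆ys))
      where
      xs⊆ys : ∀ {x} → x ∈ xs → x ∈ ys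
      xs⊆ys {x} x∈xs with x ∈? ys
      ... | yes x∈ys = x∈ys
      ... | no x∉ys = ⊥-elim (none∉ (lose x∈xs x∉ys))

module _ {A : Set} where

  length≤-of-injective-bounded : ∀ {X : List A} → Unique X → (f : A → ℕ) (B : ℕ) →
    (∀ {x y} → x ∈ X → y ∈ X → x ≢ y → f x ≢ f y) → (∀ {x} → x ∈ X → f x < B) → length X ≤ B
  length≤-of-injective-bounded {X} uX f B f-inj f<B = subst₂ _≤_ (length-map f X) (length-upTo B)
    (Unique-⊆⇒length≤ (map-unique uX id) (upTo B) fX⊆upTo)
    where
    fX⊆upTo : ∀ {y} → y ∈ map f X → y ∈ upTo B
    fX⊆upTo y∈fX with ∈-map⁻ f y∈fX
    ... | x , x∈X , refl = ∈-upTo⁺ (f<B x∈X)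

    map-unique : ∀ {xs} → Unique xs → (∀ {z} → z ∈ xs → z ∈ X) → Unique (map f xs)
    map-unique [] _ = []
    map-unique {x ∷ xs} (x∉xs ∷ uxs) xs⊆X =
      images-distinct x∉xs (λ z∈xs → xs⊆X (there z∈xs)) ∷ map-unique uxs (λ z∈xs → xs⊆X (there z∈xs))
      where
      images-distinct : ∀ {zs} → All (x ≢_) zs → (∀ {z} → z ∈ zs → z ∈ X) → All (f x ≢_) (map f zs)
      images-distinct [] _ = []
      images-distinct (x≢z ∷ x≢zs) zs⊆X = f-inj (xs⊆X (here refl)) (zs⊆X (here refl)) x≢z ∷ images-distinct x≢zs (λ m → zs⊆X (there m))

-- Walks and fault-tolerant visibility

FTMVSetOfSize : Graph → ℕ → ℕ → Set
FTMVSetOfSize G k N = Σ (List (Graph.V G)) λ X → Unique X × IsFTMV G k X × length X ≡ N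

FTMVBound : Graph → ℕ → ℕ → Set
FTMVBound G k N = ∀ X → Unique X → IsFTMV G k X → length X ≤ N

clique⇒ftmv : ∀ G {X} k → (∀ {u v} → u ∈ X → v ∈ X → u ≢ v → Graph.Adj G u v) → IsFTMV G k X
clique⇒ftmv G k clique u v u∈X v∈X u≢v ¬adj = ⊥-elim (¬adj (clique u∈X v∈X u≢v))

module Walks (G : Graph) (Adj-sym : ∀ {x y} → Graph.Adj G x y → Graph.Adj G y x) where
  open Graph G

  _++ʷ_ : ∀ {u w v ℓ ℓ'} → Walk G u w ℓ → Walk G w v ℓ' → Walk G u v (ℓ + ℓ')
  [] ++ʷ q = q
  (a ∷ p) ++ʷ q = a ∷ (p ++ʷ q)

  inner-++ʷ : ∀ {u w v ℓ ℓ' x} (p : Walk G u w ℓ) (q : Walk G w v ℓ') →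
              x ∈ inner G (p ++ʷ q) → x ∈ inner G p ⊎ x ≡ w ⊎ x ∈ inner G q
  inner-++ʷ [] q x∈ = inj₂ (inj₂ x∈)
  inner-++ʷ (a ∷ []) (b ∷ q) (here x≡w) = inj₂ (inj₁ x≡w)
  inner-++ʷ (a ∷ []) (b ∷ q) (there x∈) = inj₂ (inj₂ x∈)
  inner-++ʷ (a ∷ (b ∷ p)) q (here x≡) = inj₁ (here x≡)
  inner-++ʷ (a ∷ (b ∷ p)) q (there x∈) with inner-++ʷ (b ∷ p) q x∈
  ... | inj₁ x∈p = inj₁ (there x∈p)
  ... | inj₂ x∈rest = inj₂ x∈rest

  inner-∷ : ∀ {u w v ℓ x} (a : Adj u w) (p : Walk G w v ℓ) →
            x ∈ inner G (a ∷ p) → (x ≡ w × 0 < ℓ) ⊎ x ∈ inner G p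
  inner-∷ a (b ∷ p) (here x≡w) = inj₁ (x≡w , z<s)
  inner-∷ a (b ∷ p) (there x∈) = inj₂ x∈

  snoc : ∀ {u w v ℓ} → Walk G u w ℓ → Adj w v → Walk G u v (suc ℓ)
  snoc [] a = a ∷ []
  snoc (b ∷ p) a = b ∷ snoc p a

  inner-snoc : ∀ {u w v ℓ x} (p : Walk G u w ℓ) (a : Adj w v) →
               x ∈ inner G (snoc p a) → x ∈ inner G p ⊎ x ≡ w
  inner-snoc (b ∷ []) a (here x≡w) = inj₂ x≡w
  inner-snoc (b ∷ (c ∷ p)) a (here x≡) = inj₁ (here x≡)
  inner-snoc (b ∷ (c ∷ p)) a (there x∈) with inner-snoc (c ∷ p) a x∈
  ... | inj₁ x∈p = inj₁ (there x∈p)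
  ... | inj₂ x≡w = inj₂ x≡w

  reverse : ∀ {u v ℓ} → Walk G u v ℓ → Walk G v u ℓ
  reverse [] = []
  reverse (a ∷ p) = snoc (reverse p) (Adj-sym a)

  inner-reverse : ∀ {u v ℓ x} (p : Walk G u v ℓ) → x ∈ inner G (reverse p) → x ∈ inner G p
  inner-reverse (a ∷ (b ∷ p)) x∈ =
    [ (λ x∈p → there (inner-reverse (b ∷ p) x∈p)) , (λ x≡w → here x≡w) ]′
      (inner-snoc (reverse (b ∷ p)) (Adj-sym a) x∈)

  reverseSP : ∀ {u v} → ShortestPath G u v → ShortestPath G v u
  reverseSP (sp len walk shortest) = sp len (reverse walk) (λ ℓ' q → shortest ℓ' (reverse q))

  DisjointGeodesics : ℕ → List V → V → V → Set
  DisjointGeodesics k X u v = Σ (Fin (suc k) → ShortestPath G u v) λ Q →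
    (∀ i j → i ≢ j → ∀ x → x ∈ innerSP G (Q i) → x ∉ innerSP G (Q j))
    × (∀ i x → x ∈ innerSP G (Q i) → x ∉ X)

  DisjointGeodesics-sym : ∀ {k X u v} → DisjointGeodesics k X u v → DisjointGeodesics k X v u
  DisjointGeodesics-sym (Q , disjoint , avoid) =
    (λ i → reverseSP (Q i)) ,
    (λ i j i≢j x x∈i x∈j → disjoint i j i≢j x (inner-reverse (ShortestPath.walk (Q i)) x∈i)
                                              (inner-reverse (ShortestPath.walk (Q j)) x∈j)) ,
    (λ i x x∈i → avoid i x (inner-reverse (ShortestPath.walk (Q i)) x∈i))

  twoDisjointGeodesics : ∀ {u v X} (p q : ShortestPath G u v) →
    (∀ x → x ∈ innerSP G p → x ∉ innerSP G q) →
    (∀ x → x ∈ innerSP G p → x ∉ X) → (∀ x → x ∈ innerSP G q → x ∉ X) → DisjointGeodesics 1 X u v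
  twoDisjointGeodesics {u} {v} {X} p q p∩q=∅ p∩X=∅ q∩X=∅ = Q , disjoint , avoid
    where
    Q : Fin 2 → ShortestPath G u v
    Q fzero = p
    Q (fsuc _) = q
    disjoint : ∀ i j → i ≢ j → ∀ x → x ∈ innerSP G (Q i) → x ∉ innerSP G (Q j)
    disjoint fzero fzero i≢j = ⊥-elim (i≢j refl)
    disjoint fzero (fsuc fzero) _ x x∈p x∈q = p∩q=∅ x x∈p x∈q
    disjoint (fsuc fzero) fzero _ x x∈q x∈p = p∩q=∅ x x∈p x∈q
    disjoint (fsuc fzero) (fsuc fzero) i≢j = ⊥-elim (i≢j refl)
    avoid : ∀ i x → x ∈ innerSP G (Q i) → x ∉ X
    avoid fzero = p∩X=∅
    avoid (fsuc _) = q∩X=∅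

-- The cycle C_n

module Cycle (n : ℕ) (3≤n : 3 ≤ n) where

  -- t is the length of the walk b → b+1 → … → e going forward around C_n (for t < n).
  IsOffset : ℕ → ℕ → ℕ → Set
  IsOffset b e t = b + t ≡ e ⊎ b + t ≡ e + n

  abstract
    offsetℕ : ℕ → ℕ → ℕ
    offsetℕ b e with b ≤? e
    ... | yes _ = e ∸ b
    ... | no _ = (n ∸ b) + e

    offsetℕ-spec : ∀ b e → b < n → e < n → IsOffset b e (offsetℕ b e) × offsetℕ b e < n
    offsetℕ-spec b e b<n e<n with b ≤? e
    ... | yes b≤e = inj₁ (m+[n∸m]≡n b≤e) , ≤-<-trans (m∸n≤m e b) e<n
    ... | no b≰e = inj₂ wraps , <n
      where
      wraps : b + (n ∸ b + e) ≡ e + n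
      wraps = begin
        b + (n ∸ b + e)   ≡⟨ +-assoc b (n ∸ b) e ⟨
        b + (n ∸ b) + e   ≡⟨ cong (_+ e) (m+[n∸m]≡n (<⇒≤ b<n)) ⟩
        n + e             ≡⟨ +-comm n e ⟩
        e + n             ∎
        where open ≡-Reasoning
      <n : n ∸ b + e < n
      <n = subst (n ∸ b + e <_) (trans (+-comm (n ∸ b) b) (m+[n∸m]≡n (<⇒≤ b<n))) (+-monoʳ-< (n ∸ b) (≰⇒> b≰e))

  IsOffset-unique : ∀ {b e t t'} → t < n → t' < n → IsOffset b e t → IsOffset b e t' → t ≡ t'
  IsOffset-unique {b} _ _ (inj₁ p) (inj₁ q) = +-cancelˡ-≡ b _ _ (trans p (sym q))
  IsOffset-unique {b} _ _ (inj₂ p) (inj₂ q) = +-cancelˡ-≡ b _ _ (trans p (sym q))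
  IsOffset-unique {b} {e} {t} {t'} _ t'<n (inj₁ p) (inj₂ q) =
    ⊥-elim (<⇒≱ t'<n (subst (n ≤_) (sym (+-cancelˡ-≡ b _ _ (trans q (trans (cong (_+ n) (sym p)) (+-assoc b t n))))) (m≤n+m n t)))
  IsOffset-unique {b} {e} {t} {t'} t<n _ (inj₂ p) (inj₁ q) =
    ⊥-elim (<⇒≱ t<n (subst (n ≤_) (sym (+-cancelˡ-≡ b _ _ (trans p (trans (cong (_+ n) (sym q)) (+-assoc b t' n))))) (m≤n+m n t')))

  offset : Fin n → Fin n → ℕ
  offset b e = offsetℕ (toℕ b) (toℕ e)

  offset-isOffset : ∀ b e → IsOffset (toℕ b) (toℕ e) (offset b e)
  offset-isOffset b e = proj₁ (offsetℕ-spec (toℕ b) (toℕ e) (toℕ<n b) (toℕ<n e))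

  offset<n : ∀ b e → offset b e < n
  offset<n b e = proj₂ (offsetℕ-spec (toℕ b) (toℕ e) (toℕ<n b) (toℕ<n e))

  offset-unique : ∀ b e {t} → t < n → IsOffset (toℕ b) (toℕ e) t → offset b e ≡ t
  offset-unique b e t<n isOff = IsOffset-unique (offset<n b e) t<n (offset-isOffset b e) isOff

  1<n : 1 < n
  1<n = ≤-trans (s≤s (s≤s z≤n)) 3≤n

  offset-self : ∀ b → offset b b ≡ 0
  offset-self b = offset-unique b b (≤-<-trans z≤n (toℕ<n b)) (inj₁ (+-identityʳ _))

  offset≡0⇒≡ : ∀ {b e} → offset b e ≡ 0 → b ≡ e
  offset≡0⇒≡ {b} {e} eq with offset-isOffset b e
  ... | inj₁ p = toℕ-injective (trans (sym (trans (cong (toℕ b +_) eq) (+-identityʳ _))) p)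
  ... | inj₂ p = ⊥-elim (<⇒≱ (toℕ<n b)
                   (subst (n ≤_) (trans (sym p) (trans (cong (toℕ b +_) eq) (+-identityʳ _))) (m≤n+m n (toℕ e))))

  offset≡1⇒≢ : ∀ {b e} → offset b e ≡ 1 → b ≢ e
  offset≡1⇒≢ {b} eq refl = 0≢1+n (trans (sym (offset-self b)) eq)

  offset-injectiveʳ : ∀ b {e f} → offset b e ≡ offset b f → e ≡ f
  offset-injectiveʳ b {e} {f} eq with offset-isOffset b e | offset-isOffset b f
  ... | inj₁ p | inj₁ q = toℕ-injective (trans (sym p) (trans (cong (toℕ b +_) eq) q))
  ... | inj₂ p | inj₂ q = toℕ-injective (+-cancelʳ-≡ n _ _ (trans (sym p) (trans (cong (toℕ b +_) eq) q)))
  ... | inj₁ p | inj₂ q = ⊥-elim (<⇒≱ (toℕ<n e)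
          (subst (n ≤_) (trans (sym q) (trans (cong (toℕ b +_) (sym eq)) p)) (m≤n+m n (toℕ f))))
  ... | inj₂ p | inj₁ q = ⊥-elim (<⇒≱ (toℕ<n f)
          (subst (n ≤_) (trans (sym p) (trans (cong (toℕ b +_) eq) q)) (m≤n+m n (toℕ e))))

  private
    reduce-mod-n : ∀ x y a c → y < n → x < n + n → a ≤ 1 → c ≤ 2 → x + a * n ≡ y + c * n → x ≡ y ⊎ x ≡ y + n
    reduce-mod-n x y .0 .0 _ _ z≤n z≤n eq = inj₁ (trans (sym (+-identityʳ x)) (trans eq (+-identityʳ y)))
    reduce-mod-n x y .0 .1 _ _ z≤n (s≤s z≤n) eq = inj₂ (trans (sym (+-identityʳ x)) (trans eq (cong (y +_) (+-identityʳ n))))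
    reduce-mod-n x y .0 .2 _ x<2n z≤n (s≤s (s≤s z≤n)) eq = ⊥-elim (<⇒≱ x<2n
      (subst (n + n ≤_) (sym (trans (sym (+-identityʳ x)) (trans eq (cong (λ z → y + (n + z)) (+-identityʳ n))))) (m≤n+m (n + n) y)))
    reduce-mod-n x y .1 .0 y<n _ (s≤s z≤n) z≤n eq = ⊥-elim (<⇒≱ y<n
      (subst (n ≤_) (trans (cong (x +_) (sym (+-identityʳ n))) (trans eq (+-identityʳ y))) (m≤n+m n x)))
    reduce-mod-n x y .1 .1 _ _ (s≤s z≤n) (s≤s z≤n) eq = inj₁ (+-cancelʳ-≡ (n + 0) x y eq)
    reduce-mod-n x y .1 .2 _ _ (s≤s z≤n) (s≤s (s≤s z≤n)) eq =
      inj₂ (+-cancelʳ-≡ (n + 0) x (y + n) (trans eq (sym (+-assoc y n (n + 0)))))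

  offset-wrap : ∀ b e → Σ ℕ λ c → c ≤ 1 × toℕ b + offset b e ≡ toℕ e + c * n
  offset-wrap b e with offset-isOffset b e
  ... | inj₁ p = 0 , z≤n , trans p (sym (+-identityʳ (toℕ e)))
  ... | inj₂ p = 1 , s≤s z≤n , trans p (cong (toℕ e +_) (sym (+-identityʳ n)))

  offset-triangle : ∀ b e f → offset b e + offset e f ≡ offset b f ⊎ offset b e + offset e f ≡ offset b f + n
  offset-triangle b e f
    with offset-wrap b e | offset-wrap e f | offset-wrap b f
  ... | c₁ , c₁≤1 , p₁ | c₂ , c₂≤1 , p₂ | c₃ , c₃≤1 , p₃ =
    reduce-mod-n (offset b e + offset e f) (offset b f) c₃ (c₁ + c₂)
      (offset<n b f) (+-mono-< (offset<n b e) (offset<n e f)) c₃≤1 (+-mono-≤ c₁≤1 c₂≤1)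
      (trans (telescope-+ (toℕ b) (toℕ e) (toℕ f) p₁ p₂ p₃) (cong (offset b f +_) (sym (*-distribʳ-+ n c₁ c₂))))

  offset-trans-<n : ∀ b e f → offset b e + offset e f < n → offset b f ≡ offset b e + offset e f
  offset-trans-<n b e f sum<n with offset-triangle b e f
  ... | inj₁ p = sym p
  ... | inj₂ p = ⊥-elim (<⇒≱ sum<n (subst (n ≤_) (sym p) (m≤n+m n _)))

  offset-trans-≤ : ∀ b e f → offset b e ≤ offset b f → offset b e + offset e f ≡ offset b f
  offset-trans-≤ b e f be≤bf with offset-triangle b e f
  ... | inj₁ p = p
  ... | inj₂ p = ⊥-elim (<⇒≱ (+-monoʳ-< (offset b f) (offset<n e f))
                   (subst (_≤ offset b f + offset e f) p (+-monoˡ-≤ (offset e f) be≤bf)))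

  offset-+-reverse : ∀ {b e} → b ≢ e → offset b e + offset e b ≡ n
  offset-+-reverse {b} {e} b≢e with offset-triangle b e b
  ... | inj₁ p = ⊥-elim (b≢e (offset≡0⇒≡ (m+n≡0⇒m≡0 (offset b e) (trans p (offset-self b)))))
  ... | inj₂ p = trans p (cong (_+ n) (offset-self b))

  offset-injectiveˡ : ∀ {e f} b → offset e b ≡ offset f b → e ≡ f
  offset-injectiveˡ {e} {f} b eq with e ≟ᶠ b | f ≟ᶠ b
  ... | yes refl | yes refl = refl
  ... | yes refl | no f≢b = ⊥-elim (f≢b (offset≡0⇒≡ (trans (sym eq) (offset-self e))))
  ... | no e≢b | yes refl = ⊥-elim (e≢b (offset≡0⇒≡ (trans eq (offset-self f))))
  ... | no e≢b | no f≢b = offset-injectiveʳ b (+-cancelʳ-≡ (offset e b) _ _ (begin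
    offset b e + offset e b   ≡⟨ +-comm (offset b e) _ ⟩
    offset e b + offset b e   ≡⟨ offset-+-reverse e≢b ⟩
    n                         ≡⟨ offset-+-reverse f≢b ⟨
    offset f b + offset b f   ≡⟨ +-comm (offset f b) _ ⟩
    offset b f + offset f b   ≡⟨ cong (offset b f +_) eq ⟨
    offset b f + offset e b   ∎))
    where open ≡-Reasoning

  Neighbours : Fin n → Fin n → Set
  Neighbours h h' = offset h h' ≡ 1 ⊎ offset h' h ≡ 1

  cycleAdj⇒neighbours : ∀ {h h'} → CycleAdj n h h' → Neighbours h h'
  cycleAdj⇒neighbours {h} {h'} (inj₁ p) = inj₁ (offset-unique h h' 1<n (inj₁ (trans (+-comm (toℕ h) 1) p)))
  cycleAdj⇒neighbours {h} {h'} (inj₂ (inj₁ p)) = inj₂ (offset-unique h' h 1<n (inj₁ (trans (+-comm (toℕ h') 1) p)))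
  cycleAdj⇒neighbours {h} {h'} (inj₂ (inj₂ (inj₁ (p , q)))) =
    inj₂ (offset-unique h' h 1<n (inj₂ (trans (+-comm (toℕ h') 1) (trans q (cong (_+ n) (sym p))))))
  cycleAdj⇒neighbours {h} {h'} (inj₂ (inj₂ (inj₂ (p , q)))) =
    inj₁ (offset-unique h h' 1<n (inj₂ (trans (+-comm (toℕ h) 1) (trans q (cong (_+ n) (sym p))))))

  offset≡1⇒cycleAdj : ∀ {h h'} → offset h h' ≡ 1 → CycleAdj n h h'
  offset≡1⇒cycleAdj {h} {h'} eq with offset-isOffset h h'
  ... | inj₁ p = inj₁ (trans (+-comm 1 (toℕ h)) (trans (cong (toℕ h +_) (sym eq)) p))
  ... | inj₂ p = inj₂ (inj₂ (inj₂ (h'≡0 , trans wraps (cong (_+ n) h'≡0))))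
    where
    wraps : suc (toℕ h) ≡ toℕ h' + n
    wraps = trans (+-comm 1 (toℕ h)) (trans (cong (toℕ h +_) (sym eq)) p)
    h'≡0 : toℕ h' ≡ 0
    h'≡0 = n≤0⇒n≡0 (+-cancelʳ-≤ n (toℕ h') 0 (subst (_≤ n) wraps (toℕ<n h)))

  cycleAdj-sym : ∀ {h h'} → CycleAdj n h h' → CycleAdj n h' h
  cycleAdj-sym (inj₁ q) = inj₂ (inj₁ q)
  cycleAdj-sym (inj₂ (inj₁ q)) = inj₁ q
  cycleAdj-sym (inj₂ (inj₂ (inj₁ q))) = inj₂ (inj₂ (inj₂ q))
  cycleAdj-sym (inj₂ (inj₂ (inj₂ q))) = inj₂ (inj₂ (inj₁ q))

  abstract
    successor : ∀ b → Σ (Fin n) λ b' → offset b b' ≡ 1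
    successor b with suc (toℕ b) <? n
    ... | yes b+1<n = fromℕ< b+1<n , offset-unique b _ 1<n (inj₁ (trans (+-comm (toℕ b) 1) (sym (toℕ-fromℕ< b+1<n))))
    ... | no b+1≮n = fromℕ< (≤-trans (s≤s z≤n) 3≤n) , offset-unique b _ 1<n (inj₂ (trans (+-comm (toℕ b) 1)
                       (trans (≤-antisym (toℕ<n b) (≮⇒≥ b+1≮n)) (cong (_+ n) (sym (toℕ-fromℕ< _))))))

  offset-via-successor : ∀ {b b'} d → offset b b' ≡ 1 →
                         offset b d ≡ suc (offset b' d) ⊎ (offset b d ≡ 0 × suc (offset b' d) ≡ n)
  offset-via-successor {b} {b'} d bb'≡1 with offset-triangle b b' d
  ... | inj₁ p = inj₁ (sym (trans (cong (_+ offset b' d) (sym bb'≡1)) p))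
  ... | inj₂ p = inj₂ (bd≡0 , trans wraps (cong (_+ n) bd≡0))
    where
    wraps : suc (offset b' d) ≡ offset b d + n
    wraps = trans (cong (_+ offset b' d) (sym bb'≡1)) p
    bd≡0 : offset b d ≡ 0
    bd≡0 = n≤0⇒n≡0 (+-cancelʳ-≤ n (offset b d) 0 (subst (_≤ n) wraps (offset<n b' d)))

  record Antipodal (b d : Fin n) : Set where
    constructor antipodal
    field double-offset≡n : offset b d + offset b d ≡ n

  antipodal⇒≢ : ∀ {b d} → Antipodal b d → b ≢ d
  antipodal⇒≢ {b} (antipodal eq) refl =
    <⇒≢ (≤-trans (s≤s z≤n) 3≤n) (sym (trans (sym eq) (cong (λ z → z + z) (offset-self b))))

  antipodal-offset-sym : ∀ {b d} → Antipodal b d → offset d b ≡ offset b d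
  antipodal-offset-sym {b} {d} a@(antipodal eq) =
    +-cancelˡ-≡ (offset b d) _ _ (trans (offset-+-reverse (antipodal⇒≢ a)) (sym eq))

  antipodal-sym : ∀ {b d} → Antipodal b d → Antipodal d b
  antipodal-sym a@(antipodal eq) = antipodal (trans (cong (λ z → z + z) (antipodal-offset-sym a)) eq)

  antipodal-uniqueˡ : ∀ {b b' d} → Antipodal b d → Antipodal b' d → b ≡ b'
  antipodal-uniqueˡ {d = d} a a' = offset-injectiveʳ d (+-double-injective
    (trans (Antipodal.double-offset≡n (antipodal-sym a)) (sym (Antipodal.double-offset≡n (antipodal-sym a')))))

  antipodal-uniqueʳ : ∀ {b d d'} → Antipodal b d → Antipodal b d' → d ≡ d'
  antipodal-uniqueʳ a a' = antipodal-uniqueˡ (antipodal-sym a) (antipodal-sym a')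

  antipodal-arcs-disjoint : ∀ {b d y} → Antipodal b d → 0 < offset b y → offset b y < offset b d →
                            0 < offset d y → offset d y < offset d b → ⊥
  antipodal-arcs-disjoint {b} {d} {y} a@(antipodal eq) 0<by by<bd 0<dy dy<db =
    <-asym dy<db (subst (_< offset d y) (sym (antipodal-offset-sym a)) (subst (offset b d <_) (sym dy≡bd+by) (m<m+n _ 0<by)))
    where
    open ≡-Reasoning
    d≢y : d ≢ y
    d≢y refl = <⇒≢ 0<dy (sym (offset-self d))
    dy≡bd+by : offset d y ≡ offset b d + offset b y
    dy≡bd+by = +-cancelʳ-≡ (offset y d) _ _ (begin
      offset d y + offset y d                    ≡⟨ offset-+-reverse d≢y ⟩
      n                                          ≡⟨ eq ⟨
      offset b d + offset b d                    ≡⟨ cong (offset b d +_) (offset-trans-≤ b y d (<⇒≤ by<bd)) ⟨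
      offset b d + (offset b y + offset y d)     ≡⟨ +-assoc (offset b d) _ _ ⟨
      offset b d + offset b y + offset y d       ∎)

  arc : ℕ → ℕ
  arc t = t ⊓ (n ∸ t)

  cycDist : Fin n → Fin n → ℕ
  cycDist b e = arc (offset b e)

  cycDist-self : ∀ b → cycDist b b ≡ 0
  cycDist-self b = cong arc (offset-self b)

  antipodal⇒cycDist≡offset : ∀ {b d} → Antipodal b d → cycDist b d ≡ offset b d
  antipodal⇒cycDist≡offset {b} {d} (antipodal eq) = m≤n⇒m⊓n≡m (m+n≤o⇒m≤o∸n (offset b d) (≤-reflexive eq))

  arc-suc≤ : ∀ t → arc (suc t) ≤ suc (arc t)
  arc-suc≤ t = ⊓-mono-≤ (≤-refl {suc t}) (≤-trans (∸-monoʳ-≤ n (n≤1+n t)) (n≤1+n (n ∸ t)))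

  arc≤suc-arc-suc : ∀ t → arc t ≤ suc (arc (suc t))
  arc≤suc-arc-suc t = ⊓-mono-≤ (≤-trans (n≤1+n t) (n≤1+n (suc t))) (m∸n≤1+m∸[1+n] n t)

  arc<arc-suc⇒ : ∀ t → arc t < arc (suc t) → suc t + suc t ≤ n
  arc<arc-suc⇒ t lt with suc t + suc t ≤? n
  ... | yes le = le
  ... | no gt = ⊥-elim (<⇒≱ lt (≤-trans (m⊓n≤n (suc t) (n ∸ suc t)) (⊓-glb n∸[1+t]≤t (∸-monoʳ-≤ n (n≤1+n t)))))
    where
    n∸[1+t]≤t : n ∸ suc t ≤ t
    n∸[1+t]≤t = m≤n+o⇒m∸n≤o n (suc t) (subst (n ≤_) (+-suc t t) (≤-pred (≰⇒> gt)))

  arc<arc-suc⇐ : ∀ t → suc t + suc t ≤ n → arc t < arc (suc t)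
  arc<arc-suc⇐ t le = subst (arc t <_) (sym (m≤n⇒m⊓n≡m (m+n≤o⇒m≤o∸n (suc t) le))) (s≤s (m⊓n≤m t (n ∸ t)))

  arc-suc<arc⇒ : ∀ t → arc (suc t) < arc t → 0 < t × n ≤ t + t
  arc-suc<arc⇒ (suc t) lt with n ≤? suc t + suc t
  ... | yes le = z<s , le
  ... | no gt = ⊥-elim (<⇒≱ lt (≤-trans (m⊓n≤m (suc t) (n ∸ suc t)) (⊓-glb (n≤1+n (suc t)) 1+t≤n∸[2+t])))
    where
    1+t≤n∸[2+t] : suc t ≤ n ∸ suc (suc t)
    1+t≤n∸[2+t] = m+n≤o⇒m≤o∸n (suc t) (subst (_≤ n) (sym (+-suc (suc t) (suc t))) (≰⇒> gt))

  arc-suc<arc⇐ : ∀ t → n ≤ t + t → suc t < n → arc (suc t) < arc t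
  arc-suc<arc⇐ t le lt = subst (arc (suc t) <_) (sym (m≥n⇒m⊓n≡n (m≤n+o⇒m∸n≤o n t le)))
    (≤-<-trans (m⊓n≤n (suc t) (n ∸ suc t)) (∸-monoʳ-< {n} (n<1+n t) (<⇒≤ lt)))

  cycDist-forward-step : ∀ {h h'} d → offset h h' ≡ 1 → cycDist h d ≤ suc (cycDist h' d)
  cycDist-forward-step {h} {h'} d hh'≡1 with offset-via-successor d hh'≡1
  ... | inj₁ p = subst (λ z → arc z ≤ suc (cycDist h' d)) (sym p) (arc-suc≤ (offset h' d))
  ... | inj₂ (p , _) = subst (λ z → arc z ≤ suc (cycDist h' d)) (sym p) z≤n

  cycDist-backward-step : ∀ {h h'} d → offset h' h ≡ 1 → cycDist h d ≤ suc (cycDist h' d)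
  cycDist-backward-step {h} {h'} d h'h≡1 with offset-via-successor d h'h≡1
  ... | inj₁ p = subst (λ z → cycDist h d ≤ suc (arc z)) (sym p) (arc≤suc-arc-suc (offset h d))
  ... | inj₂ (p , q) = ≤-trans (m⊓n≤n (offset h d) (n ∸ offset h d)) (≤-trans (≤-reflexive (1+m≡n⇒n∸m≡1 q)) (s≤s z≤n))

  forward-step-closer⇒ : ∀ {b b'} d → offset b b' ≡ 1 → cycDist b' d < cycDist b d →
                         0 < offset b d × offset b d + offset b d ≤ n
  forward-step-closer⇒ {b} {b'} d bb'≡1 closer with offset-via-successor d bb'≡1
  ... | inj₁ p = subst (λ z → 0 < z × z + z ≤ n) (sym p)
                   (z<s , arc<arc-suc⇒ (offset b' d) (subst (λ z → cycDist b' d < arc z) p closer))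
  ... | inj₂ (p , _) = ⊥-elim (<⇒≱ closer (subst (λ z → arc z ≤ cycDist b' d) (sym p) z≤n))

  forward-step-closer⇐ : ∀ {b b'} d → offset b b' ≡ 1 → 0 < offset b d → offset b d + offset b d ≤ n →
                         cycDist b' d < cycDist b d
  forward-step-closer⇐ {b} {b'} d bb'≡1 pos le with offset-via-successor d bb'≡1
  ... | inj₁ p = subst (λ z → cycDist b' d < arc z) (sym p) (arc<arc-suc⇐ (offset b' d) (subst (λ z → z + z ≤ n) p le))
  ... | inj₂ (p , _) = ⊥-elim (<⇒≢ pos (sym p))

  backward-step-closer⇒ : ∀ {b b'} d → offset b' b ≡ 1 → cycDist b' d < cycDist b d →
                          0 < offset b d × n ≤ offset b d + offset b d
  backward-step-closer⇒ {b} {b'} d b'b≡1 closer with offset-via-successor d b'b≡1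
  ... | inj₁ p = arc-suc<arc⇒ (offset b d) (subst (λ z → arc z < cycDist b d) p closer)
  ... | inj₂ (p , q) = pos , subst (_≤ offset b d + offset b d) (trans (+-comm (offset b d) 1) q) (+-monoʳ-≤ (offset b d) pos)
    where
    pos : 0 < offset b d
    pos = n≢0⇒n>0 λ bd≡0 → <⇒≱ closer (subst (λ z → arc z ≤ cycDist b' d) (sym bd≡0) z≤n)

  backward-step-closer⇐ : ∀ {b b'} d → offset b' b ≡ 1 → 0 < offset b d → n ≤ offset b d + offset b d →
                          cycDist b' d < cycDist b d
  backward-step-closer⇐ {b} {b'} d b'b≡1 pos le with offset-via-successor d b'b≡1
  ... | inj₁ p = subst (λ z → arc z < cycDist b d) (sym p) (arc-suc<arc⇐ (offset b d) le (subst (_< n) p (offset<n b' d)))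
  ... | inj₂ (p , q) = subst (λ z → arc z < cycDist b d) (sym p)
                         (⊓-glb pos (≤-reflexive (sym (1+m≡n⇒n∸m≡1 q))))

  antipodal⇒offset≡half : ∀ {h b d} → n ≡ h + h → Antipodal b d → offset b d ≡ h
  antipodal⇒offset≡half n≡2h (antipodal eq) = +-double-injective (trans eq n≡2h)

  odd⇒¬antipodal : ∀ {h b d} → n ≡ suc (h + h) → ¬ Antipodal b d
  odd⇒¬antipodal {h} {b} {d} n≡2h+1 (antipodal eq) = double≢odd (offset b d) h (trans eq n≡2h+1)

  offset≡half⇒antipodal : ∀ {h b d} → n ≡ h + h → offset b d ≡ h → Antipodal b d
  offset≡half⇒antipodal n≡2h eq = antipodal (trans (cong₂ _+_ eq eq) (sym n≡2h))

  antipodal-halves : ∀ {h b d} → n ≡ h + h → Antipodal b d → (toℕ b < h × h ≤ toℕ d) ⊎ (h ≤ toℕ b × toℕ d < h)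
  antipodal-halves {h} {b} {d} n≡2h a with offset-isOffset b d | toℕ b <? h
  ... | inj₁ p | yes b<h = inj₁ (b<h , subst (h ≤_) (trans (cong (toℕ b +_) bd≡h) p) (m≤n+m h (toℕ b)))
    where bd≡h = sym (antipodal⇒offset≡half n≡2h a)
  ... | inj₁ p | no b≮h = ⊥-elim (<⇒≱ (toℕ<n d) (subst (_≤ toℕ d) (sym n≡2h)
          (subst (h + h ≤_) (trans (cong (toℕ b +_) bd≡h) p) (+-monoˡ-≤ h (≮⇒≥ b≮h)))))
    where bd≡h = sym (antipodal⇒offset≡half n≡2h a)
  ... | inj₂ p | _ = inj₂ (subst (h ≤_) (sym b≡d+h) (m≤n+m h (toℕ d)) ,
                           +-cancelʳ-< h (toℕ d) h (subst (_< h + h) b≡d+h (subst (toℕ b <_) n≡2h (toℕ<n b))))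
    where
    b≡d+h : toℕ b ≡ toℕ d + h
    b≡d+h = +-cancelʳ-≡ h _ _ (begin
      toℕ b + h            ≡⟨ cong (toℕ b +_) (antipodal⇒offset≡half n≡2h a) ⟨
      toℕ b + offset b d   ≡⟨ p ⟩
      toℕ d + n            ≡⟨ cong (toℕ d +_) n≡2h ⟩
      toℕ d + (h + h)      ≡⟨ +-assoc (toℕ d) h h ⟨
      toℕ d + h + h        ∎)
      where open ≡-Reasoning

  no-cyclic-triangle : 4 ≤ n → ∀ {x y z} → offset z x ≡ 1 → offset x y ≡ 1 → ¬ Neighbours y z
  no-cyclic-triangle 4≤n {x} {y} {z} zx≡1 xy≡1 yz~ = [ (λ yz≡1 → <⇒≢ (<-≤-trans (n<1+n 3) 4≤n) (sym (n≡3 yz≡1))) ,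
                                                    (λ zy≡1 → 1+n≢n (trans (sym zy≡2) zy≡1)) ]′ yz~
    where
    zy≡2 : offset z y ≡ 2
    zy≡2 = trans (offset-trans-<n z x y (subst (_< n) (cong₂ _+_ (sym zx≡1) (sym xy≡1)) (<-≤-trans (s≤s (s≤s (s≤s z≤n))) 4≤n)))
                 (cong₂ _+_ zx≡1 xy≡1)
    n≡3 : offset y z ≡ 1 → n ≡ 3
    n≡3 yz≡1 = trans (sym (offset-+-reverse (offset≡1⇒≢ yz≡1))) (cong₂ _+_ yz≡1 zy≡2)

-- The grid P_m □ C_n

module Grid (m n : ℕ) (3≤n : 3 ≤ n) where
  open Cycle n 3≤n public

  𝔾 : Graph
  𝔾 = PmCn m n

  V : Set
  V = Fin m × Fin n

  Adj : V → V → Set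
  Adj = Graph.Adj 𝔾

  row : V → ℕ
  row x = toℕ (proj₁ x)

  col : V → Fin n
  col = proj₂

  Adj-sym : ∀ {x y} → Adj x y → Adj y x
  Adj-sym (inj₁ (p , h~h')) = inj₁ (sym p , cycleAdj-sym h~h')
  Adj-sym (inj₂ (inj₁ q , p)) = inj₂ (inj₂ q , sym p)
  Adj-sym (inj₂ (inj₂ q , p)) = inj₂ (inj₁ q , sym p)

  open Walks 𝔾 Adj-sym public

  dist : V → V → ℕ
  dist u v = ∣ row u - row v ∣ + cycDist (col u) (col v)

  dist-self : ∀ u → dist u u ≡ 0
  dist-self u = cong₂ _+_ (∣n-n∣≡0 (row u)) (cycDist-self (col u))

  dist-step : ∀ {u w} v → Adj u w → dist u v ≤ suc (dist w v)
  dist-step {u} {w} v (inj₁ (p , h~h')) =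
    subst (λ z → dist u v ≤ z) (trans (+-suc _ _) (cong (λ z → suc (∣ toℕ z - row v ∣ + cycDist (col w) (col v))) p))
      (+-monoʳ-≤ ∣ row u - row v ∣ col-step)
    where
    col-step : cycDist (col u) (col v) ≤ suc (cycDist (col w) (col v))
    col-step = [ cycDist-forward-step (col v) , cycDist-backward-step (col v) ]′ (cycleAdj⇒neighbours h~h')
  dist-step {u} {w} v (inj₂ (g~g' , q)) =
    subst (λ z → dist u v ≤ suc (∣ row w - row v ∣ + cycDist z (col v))) q (+-monoˡ-≤ (cycDist (col u) (col v)) row-step)
    where
    row-step : ∣ row u - row v ∣ ≤ suc ∣ row w - row v ∣
    row-step = [ (λ e → subst (λ z → ∣ row u - row v ∣ ≤ suc ∣ z - row v ∣) e (∣a-e∣≤1+∣1+a-e∣ (row u) (row v))) ,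
                 (λ e → subst (λ z → ∣ z - row v ∣ ≤ suc ∣ row w - row v ∣) e (∣1+a-e∣≤1+∣a-e∣ (row w) (row v))) ]′ g~g'

  dist≤length : ∀ {u v ℓ} → Walk 𝔾 u v ℓ → dist u v ≤ ℓ
  dist≤length {u} [] = ≤-reflexive (dist-self u)
  dist≤length {u} {v} (a ∷ p) = ≤-trans (dist-step v a) (s≤s (dist≤length p))

  geodesic : ∀ {u v ℓ} (p : Walk 𝔾 u v ℓ) → ℓ ≡ dist u v → ShortestPath 𝔾 u v
  geodesic {ℓ = ℓ} p ℓ≡dist = sp ℓ p (λ ℓ' q → subst (_≤ ℓ') (sym ℓ≡dist) (dist≤length q))

  Between : ℕ → ℕ → ℕ → Set
  Between a b x = (a < x × x < b) ⊎ (b < x × x < a)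

  between⇒≢ : ∀ {a b x} → Between a b x → x ≢ a × x ≢ b
  between⇒≢ (inj₁ (a<x , x<b)) = >⇒≢ a<x , <⇒≢ x<b
  between⇒≢ (inj₂ (b<x , x<a)) = <⇒≢ x<a , >⇒≢ b<x

  upwardPath : ∀ (g g' : Fin m) (h : Fin n) k → toℕ g' ≡ toℕ g + k →
               Σ (Walk 𝔾 (g , h) (g' , h) k) λ p → ∀ x → x ∈ inner 𝔾 p → col x ≡ h × toℕ g < row x × row x < toℕ g'
  upwardPath g g' h zero g'≡g with toℕ-injective {i = g'} {j = g} (trans g'≡g (+-identityʳ _))
  ... | refl = [] , λ x ()
  upwardPath g g' h (suc k) g'≡g+1+k = (edge ∷ proj₁ rest) , inner-bounds
    where
    1+g<m : suc (toℕ g) < m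
    1+g<m = ≤-<-trans (subst (suc (toℕ g) ≤_) (sym (trans g'≡g+1+k (+-suc _ _))) (s≤s (m≤m+n (toℕ g) k))) (toℕ<n g')
    g₁ : Fin m
    g₁ = fromℕ< 1+g<m
    edge : Adj (g , h) (g₁ , h)
    edge = inj₂ (inj₁ (sym (toℕ-fromℕ< 1+g<m)) , refl)
    g'≡g₁+k : toℕ g' ≡ toℕ g₁ + k
    g'≡g₁+k = trans g'≡g+1+k (trans (+-suc _ _) (cong (_+ k) (sym (toℕ-fromℕ< 1+g<m))))
    rest = upwardPath g₁ g' h k g'≡g₁+k
    inner-bounds : ∀ x → x ∈ inner 𝔾 (edge ∷ proj₁ rest) → col x ≡ h × toℕ g < row x × row x < toℕ g'
    inner-bounds x x∈ with inner-∷ edge (proj₁ rest) x∈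
    ... | inj₁ (refl , 0<k) = refl , ≤-reflexive (sym (toℕ-fromℕ< 1+g<m)) ,
            subst (toℕ g₁ <_) (sym g'≡g₁+k) (subst (_≤ toℕ g₁ + k) (+-comm (toℕ g₁) 1) (+-monoʳ-≤ (toℕ g₁) 0<k))
    ... | inj₂ x∈rest with proj₂ rest x x∈rest
    ... | same-col , g₁<x , x<g' = same-col , <-trans (≤-reflexive (sym (toℕ-fromℕ< 1+g<m))) g₁<x , x<g'

  verticalPath : ∀ (g g' : Fin m) (h : Fin n) → Σ ℕ λ ℓ → Σ (Walk 𝔾 (g , h) (g' , h) ℓ) λ p →
                 ℓ ≡ ∣ toℕ g - toℕ g' ∣ × (∀ x → x ∈ inner 𝔾 p → col x ≡ h × Between (toℕ g) (toℕ g') (row x))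
  verticalPath g g' h with toℕ g ≤? toℕ g'
  ... | yes g≤g' = _ , proj₁ up , sym (m≤n⇒∣m-n∣≡n∸m g≤g') ,
                   (λ x x∈ → let (c , lo , hi) = proj₂ up x x∈ in c , inj₁ (lo , hi))
    where up = upwardPath g g' h (toℕ g' ∸ toℕ g) (sym (m+[n∸m]≡n g≤g'))
  ... | no g≰g' = _ , reverse (proj₁ up) , sym (m≤n⇒∣n-m∣≡n∸m (<⇒≤ (≰⇒> g≰g'))) ,
                   (λ x x∈ → let (c , lo , hi) = proj₂ up x (inner-reverse (proj₁ up) x∈) in c , inj₂ (lo , hi))
    where up = upwardPath g' g h (toℕ g ∸ toℕ g') (sym (m+[n∸m]≡n (<⇒≤ (≰⇒> g≰g'))))

  forwardPathOfLength : ∀ (g : Fin m) (h h' : Fin n) k → offset h h' ≡ k →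
    Σ (Walk 𝔾 (g , h) (g , h') k) λ p → ∀ x → x ∈ inner 𝔾 p → proj₁ x ≡ g × 0 < offset h (col x) × offset h (col x) < k
  forwardPathOfLength g h h' zero hh'≡0 with offset≡0⇒≡ hh'≡0
  ... | refl = [] , λ x ()
  forwardPathOfLength g h h' (suc k) hh'≡1+k = (edge ∷ proj₁ rest) , inner-bounds
    where
    h₁ = proj₁ (successor h)
    hh₁≡1 = proj₂ (successor h)
    h₁h'≡k : offset h₁ h' ≡ k
    h₁h'≡k with offset-via-successor h' hh₁≡1
    ... | inj₁ p = suc-injective (trans (sym p) hh'≡1+k)
    ... | inj₂ (p , _) = ⊥-elim (0≢1+n (trans (sym p) hh'≡1+k))
    edge : Adj (g , h) (g , h₁)
    edge = inj₁ (refl , offset≡1⇒cycleAdj hh₁≡1)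
    rest = forwardPathOfLength g h₁ h' k h₁h'≡k
    inner-bounds : ∀ x → x ∈ inner 𝔾 (edge ∷ proj₁ rest) → proj₁ x ≡ g × 0 < offset h (col x) × offset h (col x) < suc k
    inner-bounds x x∈ with inner-∷ edge (proj₁ rest) x∈
    ... | inj₁ (refl , 0<k) = refl , subst (0 <_) (sym hh₁≡1) z<s , subst (_< suc k) (sym hh₁≡1) (s≤s 0<k)
    ... | inj₂ x∈rest with proj₂ rest x x∈rest
    ... | same-row , _ , x<k with offset-via-successor (col x) hh₁≡1
    ... | inj₁ p = same-row , subst (0 <_) (sym p) z<s , subst (_< suc k) (sym p) (s≤s x<k)
    ... | inj₂ (_ , wraps) = ⊥-elim (<⇒≢ (<-≤-trans (s≤s x<k) (subst (_≤ n) (cong suc h₁h'≡k) (offset<n h₁ h'))) wraps)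

  forwardPath : ∀ (g : Fin m) (h h' : Fin n) → Σ (Walk 𝔾 (g , h) (g , h') (offset h h')) λ p →
    ∀ x → x ∈ inner 𝔾 p → proj₁ x ≡ g × 0 < offset h (col x) × offset h (col x) < offset h h'
  forwardPath g h h' = forwardPathOfLength g h h' (offset h h') refl

  backwardPath : ∀ (g : Fin m) (h h' : Fin n) → Σ (Walk 𝔾 (g , h) (g , h') (offset h' h)) λ p →
    ∀ x → x ∈ inner 𝔾 p → proj₁ x ≡ g × 0 < offset h' (col x) × offset h' (col x) < offset h' h
  backwardPath g h h' = reverse (proj₁ fwd) , λ x x∈ → proj₂ fwd x (inner-reverse (proj₁ fwd) x∈)
    where fwd = forwardPath g h' h

  -- y lies strictly inside the arc from h forward to h', and that arc is a shortest one.
  ForwardArc : Fin n → Fin n → Fin n → Set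
  ForwardArc h h' y = 0 < offset h y × offset h y < offset h h' × offset h h' + offset h h' ≤ n

  ShortArc : Fin n → Fin n → Fin n → Set
  ShortArc h h' y = ForwardArc h h' y ⊎ ForwardArc h' h y

  forwardArc-interior : ∀ {h h' y} → ForwardArc h h' y → y ≢ h × y ≢ h' × ¬ Antipodal h y × ¬ Antipodal h' y
  forwardArc-interior {h} {h'} {y} (0<hy , hy<hh' , 2hh'≤n) = y≢h , y≢h' , ¬antipodal-h , ¬antipodal-h'
    where
    y≢h : y ≢ h
    y≢h refl = <⇒≢ 0<hy (sym (offset-self y))
    y≢h' : y ≢ h'
    y≢h' refl = <-irrefl refl hy<hh'
    ¬antipodal-h : ¬ Antipodal h y
    ¬antipodal-h (antipodal eq) = <⇒≱ (+-mono-< hy<hh' hy<hh') (subst (offset h h' + offset h h' ≤_) (sym eq) 2hh'≤n)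
    yh'<hh' : offset y h' < offset h h'
    yh'<hh' = subst (offset y h' <_) (offset-trans-≤ h y h' (<⇒≤ hy<hh')) (+-monoˡ-≤ (offset y h') 0<hy)
    ¬antipodal-h' : ¬ Antipodal h' y
    ¬antipodal-h' a = <⇒≱ (+-mono-< yh'<hh' yh'<hh')
                        (subst (offset h h' + offset h h' ≤_) (sym (Antipodal.double-offset≡n (antipodal-sym a))) 2hh'≤n)

  shortArc-interior : ∀ {h h' y} → ShortArc h h' y → y ≢ h × y ≢ h' × ¬ Antipodal h y × ¬ Antipodal h' y
  shortArc-interior (inj₁ arc) = forwardArc-interior arc
  shortArc-interior (inj₂ arc) = let (y≢h' , y≢h , ¬a' , ¬a) = forwardArc-interior arc in y≢h , y≢h' , ¬a , ¬a'

  horizontalPath : ∀ (g : Fin m) (h h' : Fin n) → Σ ℕ λ ℓ → Σ (Walk 𝔾 (g , h) (g , h') ℓ) λ p →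
                   ℓ ≡ cycDist h h' × (∀ x → x ∈ inner 𝔾 p → proj₁ x ≡ g × ShortArc h h' (col x))
  horizontalPath g h h' with offset h h' + offset h h' ≤? n
  ... | yes 2t≤n = _ , proj₁ fwd , sym (m≤n⇒m⊓n≡m (m+n≤o⇒m≤o∸n (offset h h') 2t≤n)) ,
                   (λ x x∈ → let (r , lo , hi) = proj₂ fwd x x∈ in r , inj₁ (lo , hi , 2t≤n))
    where fwd = forwardPath g h h'
  ... | no 2t≰n = _ , proj₁ bwd , trans s≡n∸t (sym (m≥n⇒m⊓n≡n (m≤n+o⇒m∸n≤o n t (<⇒≤ (≰⇒> 2t≰n))))) ,
                   (λ x x∈ → let (r , lo , hi) = proj₂ bwd x x∈ in r , inj₂ (lo , hi , 2s≤n))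
    where
    bwd = backwardPath g h h'
    t = offset h h'
    s = offset h' h
    h≢h' : h ≢ h'
    h≢h' refl = 2t≰n (subst (λ z → z + z ≤ n) (sym (offset-self h)) z≤n)
    t+s≡n : t + s ≡ n
    t+s≡n = offset-+-reverse h≢h'
    s≡n∸t : s ≡ n ∸ t
    s≡n∸t = trans (sym (m+n∸m≡n t s)) (cong (_∸ t) t+s≡n)
    s<t : s < t
    s<t = +-cancelˡ-< t s t (subst (_< t + t) (sym t+s≡n) (≰⇒> 2t≰n))
    2s≤n : s + s ≤ n
    2s≤n = subst (s + s ≤_) (trans (+-comm s t) t+s≡n) (+-monoʳ-≤ s (<⇒≤ s<t))

  -- Inner vertices of the geodesic from (g , h) to (g' , h') that runs first along row g and then along column h'
  -- (RowFirst), or first along column h and then along row g' (ColumnFirst).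
  RowFirst : Fin m → Fin m → Fin n → Fin n → V → Set
  RowFirst g g' h h' x = (proj₁ x ≡ g × ShortArc h h' (col x)) ⊎ x ≡ (g , h') ⊎ (col x ≡ h' × Between (toℕ g) (toℕ g') (row x))

  ColumnFirst : Fin m → Fin m → Fin n → Fin n → V → Set
  ColumnFirst g g' h h' x = (col x ≡ h × Between (toℕ g) (toℕ g') (row x)) ⊎ x ≡ (g' , h) ⊎ (proj₁ x ≡ g' × ShortArc h h' (col x))

  rowFirstWalk : ∀ g g' h h' → Σ ℕ λ ℓ → Σ (Walk 𝔾 (g , h) (g' , h') ℓ) λ p →
                 ℓ ≡ dist (g , h) (g' , h') × (∀ x → x ∈ inner 𝔾 p → RowFirst g g' h h' x)
  rowFirstWalk g g' h h' = _ , hp ++ʷ vp , len , on-path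
    where
    hor = horizontalPath g h h'
    ver = verticalPath g g' h'
    hp = proj₁ (proj₂ hor)
    vp = proj₁ (proj₂ ver)
    len = trans (cong₂ _+_ (proj₁ (proj₂ (proj₂ hor))) (proj₁ (proj₂ (proj₂ ver)))) (+-comm (cycDist h h') _)
    on-path : ∀ x → x ∈ inner 𝔾 (hp ++ʷ vp) → RowFirst g g' h h' x
    on-path x x∈ with inner-++ʷ hp vp x∈
    ... | inj₁ x∈hp = inj₁ (proj₂ (proj₂ (proj₂ hor)) x x∈hp)
    ... | inj₂ (inj₁ x≡corner) = inj₂ (inj₁ x≡corner)
    ... | inj₂ (inj₂ x∈vp) = inj₂ (inj₂ (proj₂ (proj₂ (proj₂ ver)) x x∈vp))

  rowFirstGeodesic : ∀ g g' h h' → Σ (ShortestPath 𝔾 (g , h) (g' , h')) λ p → ∀ x → x ∈ innerSP 𝔾 p → RowFirst g g' h h' x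
  rowFirstGeodesic g g' h h' with rowFirstWalk g g' h h'
  ... | _ , p , len , on-path = geodesic p len , on-path

  columnFirstGeodesic : ∀ g g' h h' → Σ (ShortestPath 𝔾 (g , h) (g' , h')) λ p → ∀ x → x ∈ innerSP 𝔾 p → ColumnFirst g g' h h' x
  columnFirstGeodesic g g' h h' = geodesic (vp ++ʷ hp) len , on-path
    where
    ver = verticalPath g g' h
    hor = horizontalPath g' h h'
    vp = proj₁ (proj₂ ver)
    hp = proj₁ (proj₂ hor)
    len = cong₂ _+_ (proj₁ (proj₂ (proj₂ ver))) (proj₁ (proj₂ (proj₂ hor)))
    on-path : ∀ x → x ∈ inner 𝔾 (vp ++ʷ hp) → ColumnFirst g g' h h' x
    on-path x x∈ with inner-++ʷ vp hp x∈
    ... | inj₁ x∈vp = inj₁ (proj₂ (proj₂ (proj₂ ver)) x x∈vp)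
    ... | inj₂ (inj₁ x≡corner) = inj₂ (inj₁ x≡corner)
    ... | inj₂ (inj₂ x∈hp) = inj₂ (inj₂ (proj₂ (proj₂ (proj₂ hor)) x x∈hp))

  rowFirst-columnFirst-disjoint : ∀ {g g' h h' x} → g ≢ g' → h ≢ h' → RowFirst g g' h h' x → ¬ ColumnFirst g g' h h' x
  rowFirst-columnFirst-disjoint _ _ (inj₁ (_ , arc)) (inj₁ (c , _)) = proj₁ (shortArc-interior arc) c
  rowFirst-columnFirst-disjoint g≢g' _ (inj₁ (r , _)) (inj₂ (inj₁ refl)) = g≢g' (sym r)
  rowFirst-columnFirst-disjoint g≢g' _ (inj₁ (r , _)) (inj₂ (inj₂ (r' , _))) = g≢g' (trans (sym r) r')
  rowFirst-columnFirst-disjoint _ h≢h' (inj₂ (inj₁ refl)) (inj₁ (c , _)) = h≢h' (sym c)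
  rowFirst-columnFirst-disjoint g≢g' _ (inj₂ (inj₁ refl)) (inj₂ (inj₁ e)) = g≢g' (cong proj₁ e)
  rowFirst-columnFirst-disjoint g≢g' _ (inj₂ (inj₁ refl)) (inj₂ (inj₂ (r , _))) = g≢g' r
  rowFirst-columnFirst-disjoint _ h≢h' (inj₂ (inj₂ (c , _))) (inj₁ (c' , _)) = h≢h' (trans (sym c') c)
  rowFirst-columnFirst-disjoint _ h≢h' (inj₂ (inj₂ (c , _))) (inj₂ (inj₁ refl)) = h≢h' c
  rowFirst-columnFirst-disjoint _ _ (inj₂ (inj₂ (_ , btw))) (inj₂ (inj₂ (r , _))) = proj₂ (between⇒≢ btw) (cong toℕ r)

  lShaped-disjointGeodesics : ∀ {X} g g' h h' → g ≢ g' → h ≢ h' →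
    (∀ x → RowFirst g g' h h' x → x ∉ X) → (∀ x → ColumnFirst g g' h h' x → x ∉ X) → DisjointGeodesics 1 X (g , h) (g' , h')
  lShaped-disjointGeodesics g g' h h' g≢g' h≢h' rowFirst∩X=∅ colFirst∩X=∅ =
    twoDisjointGeodesics (proj₁ P) (proj₁ Q)
      (λ x x∈P x∈Q → rowFirst-columnFirst-disjoint g≢g' h≢h' (proj₂ P x x∈P) (proj₂ Q x x∈Q))
      (λ x x∈P → rowFirst∩X=∅ x (proj₂ P x x∈P)) (λ x x∈Q → colFirst∩X=∅ x (proj₂ Q x x∈Q))
    where
    P = rowFirstGeodesic g g' h h'
    Q = columnFirstGeodesic g g' h h'

  record StepToward (u v x : V) : Set where
    constructor step
    field
      adjacent : Adj u x
      closer : dist x v < dist u v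

  geodesic-second-vertex : ∀ {u v} (P : ShortestPath 𝔾 u v) → u ≢ v → ¬ Adj u v →
                           Σ V λ x → StepToward u v x × x ∈ innerSP 𝔾 P
  geodesic-second-vertex (sp _ [] _) u≢v _ = ⊥-elim (u≢v refl)
  geodesic-second-vertex (sp _ (a ∷ []) _) _ ¬adj = ⊥-elim (¬adj a)
  geodesic-second-vertex {u} {v} (sp len (_∷_ {w = w} a (b ∷ p)) shortest) _ _ = w , step a closer , here refl
    where
    closer : dist w v < dist u v
    closer with rowFirstWalk (proj₁ u) (proj₁ v) (col u) (col v)
    ... | _ , q , len-q , _ = <-≤-trans (s≤s (dist≤length (b ∷ p))) (subst (len ≤_) len-q (shortest _ q))

  record VerticalStep (u v x : V) : Set where
    constructor vertical
    field
      same-col : col x ≡ col u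
      consecutive : Consecutive (row u) (row x)
      closer : ∣ row x - row v ∣ < ∣ row u - row v ∣

  record HorizontalStep (u v x : V) : Set where
    constructor horizontal
    field
      same-row : proj₁ x ≡ proj₁ u
      neighbour : Neighbours (col u) (col x)
      closer : cycDist (col x) (col v) < cycDist (col u) (col v)

  step⇒vertical⊎horizontal : ∀ {u v x} → StepToward u v x → VerticalStep u v x ⊎ HorizontalStep u v x
  step⇒vertical⊎horizontal {u} {v} {x} (step (inj₁ (p , h~h')) closer) =
    inj₂ (horizontal (sym p) (cycleAdj⇒neighbours h~h')
      (+-cancelˡ-< ∣ row u - row v ∣ _ _ (subst (λ z → ∣ toℕ z - row v ∣ + cycDist (col x) (col v) < dist u v) (sym p) closer)))
  step⇒vertical⊎horizontal {u} {v} {x} (step (inj₂ (g~g' , q)) closer) =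
    inj₁ (vertical (sym q) ([ (λ e → inj₁ (sym e)) , inj₂ ]′ g~g')
      (+-cancelʳ-< (cycDist (col u) (col v)) _ _ (subst (λ z → ∣ row x - row v ∣ + cycDist z (col v) < dist u v) (sym q) closer)))

  vertical⇒step : ∀ {u v x} → VerticalStep u v x → StepToward u v x
  vertical⇒step {u} {v} {x} (vertical c r closer) =
    step (inj₂ ([ (λ e → inj₁ (sym e)) , inj₂ ]′ r , sym c))
      (subst (λ z → ∣ row x - row v ∣ + cycDist z (col v) < dist u v) (sym c) (+-monoˡ-< (cycDist (col u) (col v)) closer))

  horizontal⇒step : ∀ {u v x} → HorizontalStep u v x → StepToward u v x
  horizontal⇒step {u} {v} {x} (horizontal r o closer) =
    step (inj₁ (sym r , [ offset≡1⇒cycleAdj , (λ e → cycleAdj-sym (offset≡1⇒cycleAdj e)) ]′ o))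
      (subst (λ z → ∣ toℕ z - row v ∣ + cycDist (col x) (col v) < dist u v) (sym r) (+-monoʳ-< ∣ row u - row v ∣ closer))

  verticalStep-unique : ∀ {u v x y} → VerticalStep u v x → VerticalStep u v y → x ≡ y
  verticalStep-unique {u} {v} {x} {y} (vertical c₁ r₁ l₁) (vertical c₂ r₂ l₂) = ×-≡,≡→≡ (toℕ-injective rows , trans c₁ (sym c₂))
    where
    rows : row x ≡ row y
    rows with consecutive-closer (row v) r₁ l₁ | consecutive-closer (row v) r₂ l₂
    ... | inj₁ (p , _) | inj₁ (q , _) = trans p (sym q)
    ... | inj₂ (p , _) | inj₂ (q , _) = suc-injective (trans p (sym q))
    ... | inj₁ (_ , u<v) | inj₂ (_ , v<u) = ⊥-elim (<-asym u<v v<u)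
    ... | inj₂ (_ , v<u) | inj₁ (_ , u<v) = ⊥-elim (<-asym u<v v<u)

  same-direction⇒≡ : ∀ {u v x y} → HorizontalStep u v x → HorizontalStep u v y →
    (offset (col u) (col x) ≡ 1 × offset (col u) (col y) ≡ 1) ⊎ (offset (col x) (col u) ≡ 1 × offset (col y) (col u) ≡ 1) → x ≡ y
  same-direction⇒≡ {u} (horizontal r₁ _ _) (horizontal r₂ _ _) (inj₁ (e₁ , e₂)) =
    ×-≡,≡→≡ (trans r₁ (sym r₂) , offset-injectiveʳ (col u) (trans e₁ (sym e₂)))
  same-direction⇒≡ {u} (horizontal r₁ _ _) (horizontal r₂ _ _) (inj₂ (e₁ , e₂)) =
    ×-≡,≡→≡ (trans r₁ (sym r₂) , offset-injectiveˡ (col u) (trans e₁ (sym e₂)))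

  -- Stepping forward and backward both shorten the cyclic distance only when col v is opposite col u.
  distinct-horizontalSteps⇒antipodal : ∀ {u v x y} → HorizontalStep u v x → HorizontalStep u v y → x ≢ y → Antipodal (col u) (col v)
  distinct-horizontalSteps⇒antipodal hx hy x≢y with HorizontalStep.neighbour hx | HorizontalStep.neighbour hy
  ... | inj₁ fx | inj₁ fy = ⊥-elim (x≢y (same-direction⇒≡ hx hy (inj₁ (fx , fy))))
  ... | inj₂ bx | inj₂ by = ⊥-elim (x≢y (same-direction⇒≡ hx hy (inj₂ (bx , by))))
  ... | inj₁ fx | inj₂ by = antipodal (≤-antisym (proj₂ (forward-step-closer⇒ _ fx (HorizontalStep.closer hx)))
                                                 (proj₂ (backward-step-closer⇒ _ by (HorizontalStep.closer hy))))
  ... | inj₂ bx | inj₁ fy = antipodal (≤-antisym (proj₂ (forward-step-closer⇒ _ fy (HorizontalStep.closer hy)))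
                                                 (proj₂ (backward-step-closer⇒ _ bx (HorizontalStep.closer hx))))

  no-three-horizontalSteps : ∀ {u v x y z} → HorizontalStep u v x → HorizontalStep u v y → HorizontalStep u v z →
                             x ≢ y → x ≢ z → y ≢ z → ⊥
  no-three-horizontalSteps {u} {v} hx hy hz x≢y x≢z y≢z =
    two-sides-of-three Forward Backward forward-once backward-once x≢y x≢z y≢z (side hx) (side hy) (side hz)
    where
    Forward Backward : V → Set
    Forward w = HorizontalStep u v w × offset (col u) (col w) ≡ 1
    Backward w = HorizontalStep u v w × offset (col w) (col u) ≡ 1
    side : ∀ {w} → HorizontalStep u v w → Forward w ⊎ Backward w
    side h = Sum.map (h ,_) (h ,_) (HorizontalStep.neighbour h)
    forward-once : ∀ {a b} → a ≢ b → Forward a → ¬ Forward b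
    forward-once a≢b (ha , fa) (hb , fb) = a≢b (same-direction⇒≡ ha hb (inj₁ (fa , fb)))
    backward-once : ∀ {a b} → a ≢ b → Backward a → ¬ Backward b
    backward-once a≢b (ha , ba) (hb , bb) = a≢b (same-direction⇒≡ ha hb (inj₂ (ba , bb)))

  three-steps⇒antipodal : ∀ {u v x y z} → StepToward u v x → StepToward u v y → StepToward u v z →
                          x ≢ y → z ≢ x → z ≢ y → Antipodal (col u) (col v)
  three-steps⇒antipodal sx sy sz x≢y z≢x z≢y
    with step⇒vertical⊎horizontal sx | step⇒vertical⊎horizontal sy | step⇒vertical⊎horizontal sz
  ... | inj₁ vx | inj₁ vy | _ = ⊥-elim (x≢y (verticalStep-unique vx vy))
  ... | inj₂ hx | inj₂ hy | _ = distinct-horizontalSteps⇒antipodal hx hy x≢y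
  ... | inj₁ vx | inj₂ _ | inj₁ vz = ⊥-elim (z≢x (verticalStep-unique vz vx))
  ... | inj₁ _ | inj₂ hy | inj₂ hz = distinct-horizontalSteps⇒antipodal hz hy z≢y
  ... | inj₂ _ | inj₁ vy | inj₁ vz = ⊥-elim (z≢y (verticalStep-unique vz vy))
  ... | inj₂ hx | inj₁ _ | inj₂ hz = distinct-horizontalSteps⇒antipodal hz hx z≢x

  adjacent? : (u v : V) → Dec (Adj u v)
  adjacent? (g , h) (g' , h') =
    ((g ≟ᶠ g') ×-dec ((suc (toℕ h) ≟ toℕ h') ⊎-dec ((suc (toℕ h') ≟ toℕ h) ⊎-dec
       (((toℕ h ≟ 0) ×-dec (suc (toℕ h') ≟ n)) ⊎-dec ((toℕ h' ≟ 0) ×-dec (suc (toℕ h) ≟ n))))))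
    ⊎-dec (((suc (toℕ g) ≟ toℕ g') ⊎-dec (suc (toℕ g') ≟ toℕ g)) ×-dec (h ≟ᶠ h'))

  AdjacentBy : V → V → Set
  AdjacentBy u v = (proj₁ u ≡ proj₁ v × Neighbours (col u) (col v)) ⊎ (col u ≡ col v × Consecutive (row u) (row v))

  adjacent-cases : ∀ {u v} → Adj u v → AdjacentBy u v
  adjacent-cases (inj₁ (p , h~h')) = inj₁ (p , cycleAdj⇒neighbours h~h')
  adjacent-cases (inj₂ (g~g' , q)) = inj₂ (q , [ (λ e → inj₁ (sym e)) , inj₂ ]′ g~g')

  ≢row-≢col⇒¬adjacent : ∀ {u v} → proj₁ u ≢ proj₁ v → col u ≢ col v → ¬ Adj u v
  ≢row-≢col⇒¬adjacent r≢ _ (inj₁ (r , _)) = r≢ r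
  ≢row-≢col⇒¬adjacent _ c≢ (inj₂ (_ , c)) = c≢ c

  same-col⇒¬horizontalStep : ∀ {u v x} → col u ≡ col v → ¬ HorizontalStep u v x
  same-col⇒¬horizontalStep {u} {v} c (horizontal _ _ closer)
    with subst (_ <_) (trans (cong (λ z → cycDist z (col v)) c) (cycDist-self (col v))) closer
  ... | ()

  same-row⇒¬verticalStep : ∀ {u v x} → proj₁ u ≡ proj₁ v → ¬ VerticalStep u v x
  same-row⇒¬verticalStep {u} {v} r (vertical _ _ closer)
    with subst (_ <_) (trans (cong (λ z → ∣ row u - toℕ z ∣) (sym r)) (∣n-n∣≡0 (row u))) closer
  ... | ()

  fresh : ∀ {X} → Unique X → (ys : List V) → length ys < length X → Σ V λ w → w ∈ X × All (w ≢_) ys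
  fresh uX ys ys<X with ∃-∉-of-longer (≡-dec _≟ᶠ_ _≟ᶠ_) uX ys ys<X
  ... | w , w∈X , w∉ys = w , w∈X , ¬Any⇒All¬ ys w∉ys

  no-triangle : 4 ≤ n → ∀ {a b c} → Adj a b → Adj a c → Adj b c → b ≢ c → ⊥
  no-triangle 4≤n {a} {b} {c} ab ac bc b≢c = triangle (adjacent-cases ab) (adjacent-cases ac) (adjacent-cases bc)
    where
    neighbours⇒≢ : ∀ {x y} → Neighbours x y → x ≢ y
    neighbours⇒≢ (inj₁ xy≡1) = offset≡1⇒≢ xy≡1
    neighbours⇒≢ (inj₂ yx≡1) = ≢-sym (offset≡1⇒≢ yx≡1)
    same-row-col : proj₁ b ≡ proj₁ c → col b ≡ col c → ⊥
    same-row-col r c = b≢c (×-≡,≡→≡ (r , c))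
    triangle : AdjacentBy a b → AdjacentBy a c → AdjacentBy b c → ⊥
    triangle (inj₁ (r₁ , inj₁ ab≡1)) (inj₁ (r₂ , inj₁ ac≡1)) _ = same-row-col (trans (sym r₁) r₂) (offset-injectiveʳ (col a) (trans ab≡1 (sym ac≡1)))
    triangle (inj₁ (r₁ , inj₂ ba≡1)) (inj₁ (r₂ , inj₂ ca≡1)) _ = same-row-col (trans (sym r₁) r₂) (offset-injectiveˡ (col a) (trans ba≡1 (sym ca≡1)))
    triangle (inj₁ (_ , inj₁ ab≡1)) (inj₁ (_ , inj₂ ca≡1)) (inj₁ (_ , bc~)) = no-cyclic-triangle 4≤n ca≡1 ab≡1 bc~
    triangle (inj₁ (_ , inj₂ ba≡1)) (inj₁ (_ , inj₁ ac≡1)) (inj₁ (_ , bc~)) = no-cyclic-triangle 4≤n ba≡1 ac≡1 ([ inj₂ , inj₁ ]′ bc~)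
    triangle (inj₁ (r₁ , _)) (inj₁ (r₂ , _)) (inj₂ (c , _)) = same-row-col (trans (sym r₁) r₂) c
    triangle (inj₁ (r₁ , _)) (inj₂ (_ , ac~)) (inj₁ (r₃ , _)) = consecutive-irrefl (subst (Consecutive (row a)) (sym (cong toℕ (trans r₁ r₃))) ac~)
    triangle (inj₁ (_ , ab~)) (inj₂ (c₂ , _)) (inj₂ (c₃ , _)) = neighbours⇒≢ ab~ (trans c₂ (sym c₃))
    triangle (inj₂ (_ , ab~)) (inj₁ (r₂ , _)) (inj₁ (r₃ , _)) = consecutive-irrefl (subst (Consecutive (row a)) (cong toℕ (trans r₃ (sym r₂))) ab~)
    triangle (inj₂ (c₁ , _)) (inj₁ (_ , ac~)) (inj₂ (c₃ , _)) = neighbours⇒≢ ac~ (trans c₁ c₃)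
    triangle (inj₂ (c₁ , _)) (inj₂ (c₂ , _)) (inj₁ (r₃ , _)) = same-row-col r₃ (trans (sym c₁) c₂)
    triangle (inj₂ (_ , ab~)) (inj₂ (_ , ac~)) (inj₂ (_ , bc~)) = no-consecutive-triangle ab~ bc~ ac~

  antipodal-in-row-disjointGeodesics : ∀ {X} g {c₁ c₂} → Antipodal c₁ c₂ →
    (∀ y → (g , y) ∈ X → y ≡ c₁ ⊎ Antipodal c₁ y) → DisjointGeodesics 1 X (g , c₁) (g , c₂)
  antipodal-in-row-disjointGeodesics {X} g {c₁} {c₂} a row-g∩X = twoDisjointGeodesics P₁ P₂ disjoint avoid₁ avoid₂
    where
    fwd = forwardPath g c₁ c₂
    bwd = backwardPath g c₁ c₂
    dist≡offset : dist (g , c₁) (g , c₂) ≡ offset c₁ c₂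
    dist≡offset = trans (cong (_+ cycDist c₁ c₂) (∣n-n∣≡0 (toℕ g))) (antipodal⇒cycDist≡offset a)
    P₁ = geodesic (proj₁ fwd) (sym dist≡offset)
    P₂ = geodesic (proj₁ bwd) (trans (antipodal-offset-sym a) (sym dist≡offset))
    disjoint : ∀ x → x ∈ innerSP 𝔾 P₁ → x ∉ innerSP 𝔾 P₂
    disjoint x x∈P₁ x∈P₂ with proj₂ fwd x x∈P₁ | proj₂ bwd x x∈P₂
    ... | _ , 0<c₁x , c₁x<c₁c₂ | _ , 0<c₂x , c₂x<c₂c₁ = antipodal-arcs-disjoint a 0<c₁x c₁x<c₁c₂ 0<c₂x c₂x<c₂c₁
    in-row : ∀ {x} → proj₁ x ≡ g → x ∈ X → col x ≡ c₁ ⊎ Antipodal c₁ (col x)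
    in-row {x} r x∈X = row-g∩X (col x) (subst (_∈ X) (×-≡,≡→≡ (r , refl)) x∈X)
    avoid₁ : ∀ x → x ∈ innerSP 𝔾 P₁ → x ∉ X
    avoid₁ x x∈P₁ x∈X with proj₂ fwd x x∈P₁
    ... | r , 0<c₁x , c₁x<c₁c₂ = [ (λ e → <⇒≢ 0<c₁x (sym (trans (cong (offset c₁) e) (offset-self c₁)))) ,
                                   (λ a' → <⇒≢ c₁x<c₁c₂ (cong (offset c₁) (antipodal-uniqueʳ a' a))) ]′ (in-row r x∈X)
    avoid₂ : ∀ x → x ∈ innerSP 𝔾 P₂ → x ∉ X
    avoid₂ x x∈P₂ x∈X with proj₂ bwd x x∈P₂
    ... | r , 0<c₂x , c₂x<c₂c₁ = [ (λ e → <⇒≢ c₂x<c₂c₁ (cong (offset c₂) e)) ,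
                                   (λ a' → <⇒≢ 0<c₂x (sym (trans (cong (offset c₂) (antipodal-uniqueʳ a' a)) (offset-self c₂)))) ]′ (in-row r x∈X)

-- Upper bounds

module FreeSteps (m n : ℕ) (3≤n : 3 ≤ n) {k : ℕ} {X : List (Fin m × Fin n)} (ft : IsFTMV (PmCn m n) k X) where
  open Grid m n 3≤n

  module _ {u v} (u∈X : u ∈ X) (v∈X : v ∈ X) (u≢v : u ≢ v) (¬adj : ¬ Adj u v) where
    private
      Q = proj₁ (ft u v u∈X v∈X u≢v ¬adj)
      disjoint = proj₁ (proj₂ (ft u v u∈X v∈X u≢v ¬adj))
      avoid = proj₂ (proj₂ (ft u v u∈X v∈X u≢v ¬adj))

      second-vertex : ∀ i → Σ V λ x → StepToward u v x × x ∈ innerSP 𝔾 (Q i)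
      second-vertex i = geodesic-second-vertex (Q i) u≢v ¬adj

    free-step : Fin (suc k) → V
    free-step i = proj₁ (second-vertex i)

    free-step-toward : ∀ i → StepToward u v (free-step i)
    free-step-toward i = proj₁ (proj₂ (second-vertex i))

    free-step∉X : ∀ i → free-step i ∉ X
    free-step∉X i = avoid i _ (proj₂ (proj₂ (second-vertex i)))

    free-step-injective : ∀ {i j} → i ≢ j → free-step i ≢ free-step j
    free-step-injective {i} {j} i≢j e =
      disjoint i j i≢j _ (proj₂ (proj₂ (second-vertex i))) (subst (_∈ innerSP 𝔾 (Q j)) (sym e) (proj₂ (proj₂ (second-vertex j))))

module FaultTolerant (m n : ℕ) (3≤n : 3 ≤ n) {k : ℕ} {X : List (Fin m × Fin n)}
                     (ft : IsFTMV (PmCn m n) k X) (1≤k : 1 ≤ k) where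
  open Grid m n 3≤n
  open FreeSteps m n 3≤n ft

  two-free-steps : ∀ {u v} → u ∈ X → v ∈ X → u ≢ v → ¬ Adj u v →
    Σ V λ x → Σ V λ y → StepToward u v x × StepToward u v y × x ∉ X × y ∉ X × x ≢ y
  two-free-steps u∈X v∈X u≢v ¬adj =
    free-step u∈X v∈X u≢v ¬adj i₀ , free-step u∈X v∈X u≢v ¬adj i₁ ,
    free-step-toward u∈X v∈X u≢v ¬adj i₀ , free-step-toward u∈X v∈X u≢v ¬adj i₁ ,
    free-step∉X u∈X v∈X u≢v ¬adj i₀ , free-step∉X u∈X v∈X u≢v ¬adj i₁ ,
    free-step-injective u∈X v∈X u≢v ¬adj (fromℕ<-≢ z<s (s≤s 1≤k) 0≢1+n)
    where
    i₀ i₁ : Fin (suc k)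
    i₀ = fromℕ< z<s
    i₁ = fromℕ< (s≤s 1≤k)

  step-in-X⇒antipodal : ∀ {u v z} → u ∈ X → v ∈ X → u ≢ v → ¬ Adj u v → z ∈ X → StepToward u v z → Antipodal (col u) (col v)
  step-in-X⇒antipodal u∈X v∈X u≢v ¬adj z∈X sz with two-free-steps u∈X v∈X u≢v ¬adj
  ... | x , y , sx , sy , x∉X , y∉X , x≢y = three-steps⇒antipodal sx sy sz x≢y (λ { refl → x∉X z∈X }) (λ { refl → y∉X z∈X })

  same-row⇒antipodal : ∀ {u v} → u ∈ X → v ∈ X → u ≢ v → ¬ Adj u v → proj₁ u ≡ proj₁ v → Antipodal (col u) (col v)
  same-row⇒antipodal u∈X v∈X u≢v ¬adj r with two-free-steps u∈X v∈X u≢v ¬adj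
  ... | x , y , sx , sy , _ , _ , x≢y with step⇒vertical⊎horizontal sx | step⇒vertical⊎horizontal sy
  ... | inj₂ hx | inj₂ hy = distinct-horizontalSteps⇒antipodal hx hy x≢y
  ... | inj₁ vx | _ = ⊥-elim (same-row⇒¬verticalStep r vx)
  ... | inj₂ _ | inj₁ vy = ⊥-elim (same-row⇒¬verticalStep r vy)

  same-col⇒consecutive : ∀ {u v} → u ∈ X → v ∈ X → u ≢ v → col u ≡ col v → Consecutive (row u) (row v)
  same-col⇒consecutive {u} {v} u∈X v∈X u≢v c with adjacent? u v
  ... | yes adj = [ (λ (r , _) → ⊥-elim (u≢v (×-≡,≡→≡ (r , c)))) , proj₂ ]′ (adjacent-cases adj)
  ... | no ¬adj with two-free-steps u∈X v∈X u≢v ¬adj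
  ... | x , y , sx , sy , _ , _ , x≢y with step⇒vertical⊎horizontal sx | step⇒vertical⊎horizontal sy
  ... | inj₁ vx | inj₁ vy = ⊥-elim (x≢y (verticalStep-unique vx vy))
  ... | inj₂ hx | _ = ⊥-elim (same-col⇒¬horizontalStep c hx)
  ... | inj₁ _ | inj₂ hy = ⊥-elim (same-col⇒¬horizontalStep c hy)

  no-three-in-col : ∀ {a b c} → a ∈ X → b ∈ X → c ∈ X → a ≢ b → b ≢ c → a ≢ c → col a ≡ col b → col b ≡ col c → ⊥
  no-three-in-col a∈X b∈X c∈X a≢b b≢c a≢c ab bc =
    no-consecutive-triangle (same-col⇒consecutive a∈X b∈X a≢b ab) (same-col⇒consecutive b∈X c∈X b≢c bc)
                            (same-col⇒consecutive a∈X c∈X a≢c (trans ab bc))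

  vertical-step-in-X⇒antipodal : ∀ {u x w} → u ∈ X → x ∈ X → w ∈ X → w ≢ u → col w ≢ col u →
                                 VerticalStep u w x → Antipodal (col u) (col w)
  vertical-step-in-X⇒antipodal u∈X x∈X w∈X w≢u cw≢cu vstep =
    step-in-X⇒antipodal u∈X w∈X (≢-sym w≢u) (≢row-≢col⇒¬adjacent (λ r → same-row⇒¬verticalStep r vstep) (≢-sym cw≢cu))
                        x∈X (vertical⇒step vstep)

  consecutive-in-col⇒antipodal : ∀ {a c w} → a ∈ X → c ∈ X → w ∈ X → col a ≡ col c → Consecutive (row a) (row c) →
                                 w ≢ a → w ≢ c → col w ≢ col a → Antipodal (col a) (col w)
  consecutive-in-col⇒antipodal {w = w} a∈X c∈X w∈X ac a~c w≢a w≢c cw≢ca with consecutive⇒∣-∣-distinct a~c (row w)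
  ... | inj₁ c-closer = vertical-step-in-X⇒antipodal a∈X c∈X w∈X w≢a cw≢ca (vertical (sym ac) a~c c-closer)
  ... | inj₂ a-closer = subst (λ z → Antipodal z (col w)) (sym ac)
          (vertical-step-in-X⇒antipodal c∈X a∈X w∈X w≢c (λ e → cw≢ca (trans e (sym ac))) (vertical ac (consecutive-sym a~c) a-closer))

  -- The third alternative says that n is odd and col w is the vertex of C_n opposite the edge col p — col q.
  RowEdgeWitness : V → V → V → Set
  RowEdgeWitness p q w = Antipodal (col p) (col w) ⊎ Antipodal (col q) (col w) ⊎ offset (col p) (col w) + offset (col p) (col w) ≡ suc n

  private
    module RowEdge {p q w} (p∈X : p ∈ X) (q∈X : q ∈ X) (w∈X : w ∈ X) (pq-row : proj₁ p ≡ proj₁ q)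
                           (pq≡1 : offset (col p) (col q) ≡ 1) (w≢p : w ≢ p) (w≢q : w ≢ q)
                           (cw≢cp : col w ≢ col p) (cw≢cq : col w ≢ col q) where
      b = col p
      b' = col q
      f = col w
      t' = offset b' f

      pw≡1+qw : offset b f ≡ suc t'
      pw≡1+qw with offset-via-successor f pq≡1
      ... | inj₁ eq = eq
      ... | inj₂ (pw≡0 , _) = ⊥-elim (cw≢cp (sym (offset≡0⇒≡ pw≡0)))

      same-row : proj₁ w ≡ proj₁ p → RowEdgeWitness p q w
      same-row r with adjacent? p w | adjacent? q w
      ... | no ¬adj | _ = inj₁ (same-row⇒antipodal p∈X w∈X (≢-sym w≢p) ¬adj (sym r))
      ... | yes _ | no ¬adj = inj₂ (inj₁ (same-row⇒antipodal q∈X w∈X (≢-sym w≢q) ¬adj (trans (sym pq-row) (sym r))))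
      ... | yes pw | yes qw with adjacent-cases pw | adjacent-cases qw
      ... | inj₂ (c , _) | _ = ⊥-elim (cw≢cp (sym c))
      ... | inj₁ _ | inj₂ (c , _) = ⊥-elim (cw≢cq (sym c))
      ... | inj₁ (_ , inj₁ pw≡1) | inj₁ _ = ⊥-elim (cw≢cq (offset-injectiveʳ b (trans pw≡1 (sym pq≡1))))
      ... | inj₁ (_ , inj₂ wp≡1) | inj₁ (_ , inj₂ wq≡1) = ⊥-elim (offset≡1⇒≢ pq≡1 (offset-injectiveʳ f (trans wp≡1 (sym wq≡1))))
      ... | inj₁ (_ , inj₂ wp≡1) | inj₁ (_ , inj₁ qw≡1) = inj₂ (inj₂ (trans (cong (λ z → z + z) pw≡2) (cong suc (sym n≡3))))
        where
        pw≡2 : offset b f ≡ 2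
        pw≡2 = trans pw≡1+qw (cong suc qw≡1)
        n≡3 : n ≡ 3
        n≡3 = trans (sym (offset-+-reverse (≢-sym cw≢cp))) (cong₂ _+_ pw≡2 wp≡1)

      other-row : proj₁ w ≢ proj₁ p → RowEdgeWitness p q w
      other-row r with offset b f + offset b f ≤? n
      ... | yes 2pw≤n = inj₁ (step-in-X⇒antipodal p∈X w∈X (≢-sym w≢p) (≢row-≢col⇒¬adjacent (≢-sym r) (≢-sym cw≢cp)) q∈X
                          (horizontal⇒step (horizontal (sym pq-row) (inj₁ pq≡1)
                            (forward-step-closer⇐ f pq≡1 (subst (0 <_) (sym pw≡1+qw) z<s) 2pw≤n))))
      ... | no 2pw≰n with n ≤? t' + t'
      ... | yes n≤2qw = inj₂ (inj₁ (step-in-X⇒antipodal q∈X w∈X (≢-sym w≢q)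
                          (≢row-≢col⇒¬adjacent (λ e → r (trans (sym e) (sym pq-row))) (≢-sym cw≢cq)) p∈X
                          (horizontal⇒step (horizontal pq-row (inj₂ pq≡1) (backward-step-closer⇐ f pq≡1 0<qw n≤2qw)))))
        where
        0<qw : 0 < t'
        0<qw = n≢0⇒n>0 (λ e → <⇒≱ (≤-trans (s≤s z≤n) 3≤n) (subst (λ z → n ≤ z + z) e n≤2qw))
      ... | no n≰2qw = inj₂ (inj₂ (trans (cong (λ z → z + z) pw≡1+qw) (trans (cong suc (+-suc t' t')) (cong suc (sym n≡1+2qw)))))
        where
        n≡1+2qw : n ≡ suc (t' + t')
        n≡1+2qw = ≤-antisym (≤-pred (subst (n <_) (trans (cong (λ z → z + z) pw≡1+qw) (cong suc (+-suc t' t'))) (≰⇒> 2pw≰n)))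
                            (≰⇒> n≰2qw)

  row-edge⇒witness : ∀ {p q w} → p ∈ X → q ∈ X → w ∈ X → proj₁ p ≡ proj₁ q → offset (col p) (col q) ≡ 1 →
                     w ≢ p → w ≢ q → col w ≢ col p → col w ≢ col q → RowEdgeWitness p q w
  row-edge⇒witness {p} {q} {w} p∈X q∈X w∈X pq-row pq≡1 w≢p w≢q cw≢cp cw≢cq with proj₁ w ≟ᶠ proj₁ p
  ... | yes r = RowEdge.same-row p∈X q∈X w∈X pq-row pq≡1 w≢p w≢q cw≢cp cw≢cq r
  ... | no r = RowEdge.other-row p∈X q∈X w∈X pq-row pq≡1 w≢p w≢q cw≢cp cw≢cq r

  module NoAntipodes (no-antipodes : ∀ {b d} → ¬ Antipodal b d) where

    col-pair⇒no-third : ∀ {a c w} → a ∈ X → c ∈ X → w ∈ X → a ≢ c → col a ≡ col c → w ≢ a → w ≢ c → ⊥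
    col-pair⇒no-third {a} {c} {w} a∈X c∈X w∈X a≢c ac w≢a w≢c with col w ≟ᶠ col a
    ... | yes wa = no-three-in-col a∈X c∈X w∈X a≢c (≢-sym w≢c) (≢-sym w≢a) ac (trans (sym ac) (sym wa))
    ... | no cw≢ca = no-antipodes (consecutive-in-col⇒antipodal a∈X c∈X w∈X ac (same-col⇒consecutive a∈X c∈X a≢c ac) w≢a w≢c cw≢ca)

    same-row⇒neighbours : ∀ {u v} → u ∈ X → v ∈ X → u ≢ v → proj₁ u ≡ proj₁ v →
                          Neighbours (col u) (col v)
    same-row⇒neighbours {u} {v} u∈X v∈X u≢v r with adjacent? u v
    ... | no ¬adj = ⊥-elim (no-antipodes (same-row⇒antipodal u∈X v∈X u≢v ¬adj r))
    ... | yes adj = [ proj₂ , (λ (c , _) → ⊥-elim (u≢v (×-≡,≡→≡ (r , c)))) ]′ (adjacent-cases adj)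

    row-edge⇒opposite : ∀ {p q w} → p ∈ X → q ∈ X → w ∈ X → proj₁ p ≡ proj₁ q → offset (col p) (col q) ≡ 1 →
                        w ≢ p → w ≢ q → offset (col p) (col w) + offset (col p) (col w) ≡ suc n
    row-edge⇒opposite {p} {q} {w} p∈X q∈X w∈X pq-row pq≡1 w≢p w≢q with col w ≟ᶠ col p | col w ≟ᶠ col q
    ... | yes wp | _ = ⊥-elim (col-pair⇒no-third w∈X p∈X q∈X w≢p wp (≢-sym w≢q) (≢-sym (offset≡1⇒≢ pq≡1 ∘ cong col)))
    ... | no _ | yes wq = ⊥-elim (col-pair⇒no-third w∈X q∈X p∈X w≢q wq (≢-sym w≢p) (offset≡1⇒≢ pq≡1 ∘ cong col))
    ... | no cw≢cp | no cw≢cq with row-edge⇒witness p∈X q∈X w∈X pq-row pq≡1 w≢p w≢q cw≢cp cw≢cq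
    ... | inj₁ a = ⊥-elim (no-antipodes a)
    ... | inj₂ (inj₁ a) = ⊥-elim (no-antipodes a)
    ... | inj₂ (inj₂ opposite) = opposite

    -- Two further vertices would both be opposite the edge, hence share a column with each other.
    row-edge⇒≤1-other : ∀ {p q w₁ w₂} → p ∈ X → q ∈ X → w₁ ∈ X → w₂ ∈ X → proj₁ p ≡ proj₁ q → offset (col p) (col q) ≡ 1 →
                        w₁ ≢ p → w₁ ≢ q → w₂ ≢ p → w₂ ≢ q → w₁ ≢ w₂ → ⊥
    row-edge⇒≤1-other {p} {q} {w₁} {w₂} p∈X q∈X w₁∈X w₂∈X pq-row pq≡1 w₁≢p w₁≢q w₂≢p w₂≢q w₁≢w₂ =
      col-pair⇒no-third w₁∈X w₂∈X p∈X w₁≢w₂ same-col (≢-sym w₁≢p) (≢-sym w₂≢p)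
      where
      same-col : col w₁ ≡ col w₂
      same-col = offset-injectiveʳ (col p) (+-double-injective
        (trans (row-edge⇒opposite p∈X q∈X w₁∈X pq-row pq≡1 w₁≢p w₁≢q) (sym (row-edge⇒opposite p∈X q∈X w₂∈X pq-row pq≡1 w₂≢p w₂≢q))))

    length≤3⊔m⊓n : Unique X → length X ≤ 3 ⊔ (m ⊓ n)
    length≤3⊔m⊓n uX with length X ≤? 3
    ... | yes ≤3 = ≤-trans ≤3 (m≤m⊔n 3 (m ⊓ n))
    ... | no ≰3 = ≤-trans (⊓-glb (length≤-of-injective-bounded uX row m rows-distinct (λ {x} _ → toℕ<n (proj₁ x)))
                                 (length≤-of-injective-bounded uX (toℕ ∘ col) n cols-distinct (λ {x} _ → toℕ<n (col x))))
                          (m≤n⊔m 3 (m ⊓ n))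
      where
      3<|X| : 3 < length X
      3<|X| = ≰⇒> ≰3
      no-row-edge : ∀ {p q} → p ∈ X → q ∈ X → proj₁ p ≡ proj₁ q → offset (col p) (col q) ≡ 1 → ⊥
      no-row-edge {p} {q} p∈X q∈X pq-row pq≡1 with fresh uX (p ∷ q ∷ []) (<-trans (n<1+n 2) 3<|X|)
      ... | w₁ , w₁∈X , w₁≢p ∷ w₁≢q ∷ [] with fresh uX (p ∷ q ∷ w₁ ∷ []) 3<|X|
      ... | w₂ , w₂∈X , w₂≢p ∷ w₂≢q ∷ w₂≢w₁ ∷ [] =
        row-edge⇒≤1-other p∈X q∈X w₁∈X w₂∈X pq-row pq≡1 w₁≢p w₁≢q w₂≢p w₂≢q (≢-sym w₂≢w₁)
      rows-distinct : ∀ {x y} → x ∈ X → y ∈ X → x ≢ y → row x ≢ row y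
      rows-distinct x∈X y∈X x≢y r with same-row⇒neighbours x∈X y∈X x≢y (toℕ-injective r)
      ... | inj₁ xy≡1 = no-row-edge x∈X y∈X (toℕ-injective r) xy≡1
      ... | inj₂ yx≡1 = no-row-edge y∈X x∈X (sym (toℕ-injective r)) yx≡1
      cols-distinct : ∀ {x y} → x ∈ X → y ∈ X → x ≢ y → toℕ (col x) ≢ toℕ (col y)
      cols-distinct {x} {y} x∈X y∈X x≢y c with fresh uX (x ∷ y ∷ []) (<-trans (n<1+n 2) 3<|X|)
      ... | w , w∈X , w≢x ∷ w≢y ∷ [] = col-pair⇒no-third x∈X y∈X w∈X x≢y (toℕ-injective c) w≢x w≢y

  module EvenCycle (uX : Unique X) (h : ℕ) (n≡2h : n ≡ h + h) (4<|X| : 4 < length X) where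

    data ThreeOthers (x y : V) : Set where
      three : ∀ {w₁ w₂ w₃} → w₁ ∈ X → w₂ ∈ X → w₃ ∈ X → All (w₁ ≢_) (x ∷ y ∷ []) → All (w₂ ≢_) (x ∷ y ∷ w₁ ∷ []) →
              All (w₃ ≢_) (x ∷ y ∷ w₁ ∷ w₂ ∷ []) → ThreeOthers x y

    three-others : ∀ x y → ThreeOthers x y
    three-others x y with fresh uX (x ∷ y ∷ []) (<-trans (s≤s (s≤s (s≤s z≤n))) (<-trans (n<1+n 3) 4<|X|))
    ... | w₁ , w₁∈X , w₁-fresh with fresh uX (x ∷ y ∷ w₁ ∷ []) (<-trans (n<1+n 3) 4<|X|)
    ... | w₂ , w₂∈X , w₂-fresh with fresh uX (x ∷ y ∷ w₁ ∷ w₂ ∷ []) 4<|X|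
    ... | w₃ , w₃∈X , w₃-fresh = three w₁∈X w₂∈X w₃∈X w₁-fresh w₂-fresh w₃-fresh

    col-pair⇒antipodal : ∀ {x y w} → x ∈ X → y ∈ X → w ∈ X → x ≢ y → col x ≡ col y → w ≢ x → w ≢ y → Antipodal (col x) (col w)
    col-pair⇒antipodal {x} {y} {w} x∈X y∈X w∈X x≢y xy w≢x w≢y with col w ≟ᶠ col x
    ... | yes wx = ⊥-elim (no-three-in-col x∈X y∈X w∈X x≢y (≢-sym w≢y) (≢-sym w≢x) xy (trans (sym xy) (sym wx)))
    ... | no cw≢cx = consecutive-in-col⇒antipodal x∈X y∈X w∈X xy (same-col⇒consecutive x∈X y∈X x≢y xy) w≢x w≢y cw≢cx

    -- The three other vertices would all lie in the column opposite col x.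
    cols-distinct : ∀ {x y} → x ∈ X → y ∈ X → x ≢ y → col x ≢ col y
    cols-distinct {x} {y} x∈X y∈X x≢y xy with three-others x y
    ... | three w₁∈X w₂∈X w₃∈X (w₁≢x ∷ w₁≢y ∷ []) (w₂≢x ∷ w₂≢y ∷ w₂≢w₁ ∷ []) (w₃≢x ∷ w₃≢y ∷ w₃≢w₁ ∷ w₃≢w₂ ∷ []) =
      no-three-in-col w₁∈X w₂∈X w₃∈X (≢-sym w₂≢w₁) (≢-sym w₃≢w₂) (≢-sym w₃≢w₁)
        (antipodal-uniqueʳ opposite₁ opposite₂) (antipodal-uniqueʳ opposite₂ opposite₃)
      where
      opposite₁ = col-pair⇒antipodal x∈X y∈X w₁∈X x≢y xy w₁≢x w₁≢y
      opposite₂ = col-pair⇒antipodal x∈X y∈X w₂∈X x≢y xy w₂≢x w₂≢y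
      opposite₃ = col-pair⇒antipodal x∈X y∈X w₃∈X x≢y xy w₃≢x w₃≢y

    Opposite : Fin n → V → Set
    Opposite c w = w ∈ X × Antipodal c (col w)

    opposite-once : ∀ c {wa wb} → wa ≢ wb → Opposite c wa → ¬ Opposite c wb
    opposite-once c wa≢wb (wa∈X , a) (wb∈X , b) = cols-distinct wa∈X wb∈X wa≢wb (antipodal-uniqueʳ a b)

    even⇒antipodal-side : ∀ {p q w} → RowEdgeWitness p q w → Antipodal (col p) (col w) ⊎ Antipodal (col q) (col w)
    even⇒antipodal-side (inj₁ a) = inj₁ a
    even⇒antipodal-side (inj₂ (inj₁ a)) = inj₂ a
    even⇒antipodal-side {p} {w = w} (inj₂ (inj₂ opposite)) = ⊥-elim (double≢odd (offset (col p) (col w)) h (trans opposite (cong suc n≡2h)))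

    -- Each of three other vertices is opposite col p or col q, so two of them would share a column.
    no-row-edge : ∀ {p q} → p ∈ X → q ∈ X → proj₁ p ≡ proj₁ q → offset (col p) (col q) ≡ 1 → ⊥
    no-row-edge {p} {q} p∈X q∈X pq-row pq≡1 with three-others p q
    ... | three w₁∈X w₂∈X w₃∈X (w₁≢p ∷ w₁≢q ∷ []) (w₂≢p ∷ w₂≢q ∷ w₂≢w₁ ∷ []) (w₃≢p ∷ w₃≢q ∷ w₃≢w₁ ∷ w₃≢w₂ ∷ []) =
      two-sides-of-three (Opposite (col p)) (Opposite (col q)) (opposite-once (col p)) (opposite-once (col q))
        (≢-sym w₂≢w₁) (≢-sym w₃≢w₁) (≢-sym w₃≢w₂) (side w₁∈X w₁≢p w₁≢q) (side w₂∈X w₂≢p w₂≢q) (side w₃∈X w₃≢p w₃≢q)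
      where
      side : ∀ {w} → w ∈ X → w ≢ p → w ≢ q → Opposite (col p) w ⊎ Opposite (col q) w
      side {w} w∈X w≢p w≢q = Sum.map (w∈X ,_) (w∈X ,_) (even⇒antipodal-side {p} {q} {w}
        (row-edge⇒witness p∈X q∈X w∈X pq-row pq≡1 w≢p w≢q (cols-distinct w∈X p∈X w≢p) (cols-distinct w∈X q∈X w≢q)))

    same-row⇒antipodal′ : ∀ {x y} → x ∈ X → y ∈ X → x ≢ y → proj₁ x ≡ proj₁ y → Antipodal (col x) (col y)
    same-row⇒antipodal′ {x} {y} x∈X y∈X x≢y r with adjacent? x y
    ... | no ¬adj = same-row⇒antipodal x∈X y∈X x≢y ¬adj r
    ... | yes adj with adjacent-cases adj
    ... | inj₂ (c , _) = ⊥-elim (cols-distinct x∈X y∈X x≢y c)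
    ... | inj₁ (_ , inj₁ xy≡1) = ⊥-elim (no-row-edge x∈X y∈X r xy≡1)
    ... | inj₁ (_ , inj₂ yx≡1) = ⊥-elim (no-row-edge y∈X x∈X (sym r) yx≡1)

    block : ℕ → ℕ
    block c with c <? h
    ... | yes _ = 0
    ... | no _ = m

    block-cases : ∀ c → (c < h × block c ≡ 0) ⊎ (h ≤ c × block c ≡ m)
    block-cases c with c <? h
    ... | yes c<h = inj₁ (c<h , refl)
    ... | no c≮h = inj₂ (≮⇒≥ c≮h , refl)

    block∈ : ∀ c → block c ≡ 0 ⊎ block c ≡ m
    block∈ c = [ inj₁ ∘ proj₂ , inj₂ ∘ proj₂ ]′ (block-cases c)

    -- Antipodal columns lie in opposite halves of C_n, so this code separates the two vertices of a row.
    code : V → ℕ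
    code x = block (toℕ (col x)) + row x

    code-injective : 2 ≤ m → ∀ {x y} → x ∈ X → y ∈ X → x ≢ y → code x ≢ code y
    code-injective 2≤m {x} {y} x∈X y∈X x≢y eq
      with block-+-injective (block∈ (toℕ (col x))) (block∈ (toℕ (col y))) (toℕ<n (proj₁ x)) (toℕ<n (proj₁ y)) eq
    ... | blocks , rows = different-blocks (antipodal-halves n≡2h (same-row⇒antipodal′ x∈X y∈X x≢y (toℕ-injective rows)))
                            (block-cases (toℕ (col x))) (block-cases (toℕ (col y))) blocks
      where
      0≢m : 0 ≢ m
      0≢m = <⇒≢ (≤-trans (s≤s z≤n) 2≤m)
      different-blocks : ∀ {a b} → (a < h × h ≤ b) ⊎ (h ≤ a × b < h) →
                         (a < h × block a ≡ 0) ⊎ (h ≤ a × block a ≡ m) → (b < h × block b ≡ 0) ⊎ (h ≤ b × block b ≡ m) →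
                         block a ≢ block b
      different-blocks (inj₁ (a<h , _)) (inj₂ (h≤a , _)) _ = ⊥-elim (<⇒≱ a<h h≤a)
      different-blocks (inj₁ (_ , h≤b)) _ (inj₁ (b<h , _)) = ⊥-elim (<⇒≱ b<h h≤b)
      different-blocks (inj₁ _) (inj₁ (_ , a0)) (inj₂ (_ , bm)) e = 0≢m (trans (sym a0) (trans e bm))
      different-blocks (inj₂ (h≤a , _)) (inj₁ (a<h , _)) _ = ⊥-elim (<⇒≱ a<h h≤a)
      different-blocks (inj₂ (_ , b<h)) _ (inj₂ (h≤b , _)) = ⊥-elim (<⇒≱ b<h h≤b)
      different-blocks (inj₂ _) (inj₂ (_ , am)) (inj₁ (_ , b0)) e = 0≢m (trans (sym b0) (trans (sym e) am))

    code<2m : ∀ {x} → code x < 2 * m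
    code<2m {x} = subst (code x <_) (cong (m +_) (sym (+-identityʳ m)))
      (+-mono-≤-< ([ (λ e → ≤-trans (≤-reflexive e) z≤n) , ≤-reflexive ]′ (block∈ (toℕ (col x)))) (toℕ<n (proj₁ x)))

  length≤2m⊓n : Unique X → ∀ h → n ≡ h + h → 2 ≤ m → 4 ≤ n → length X ≤ (2 * m) ⊓ n
  length≤2m⊓n uX h n≡2h 2≤m 4≤n with length X ≤? 4
  ... | yes ≤4 = ⊓-glb (≤-trans ≤4 (*-monoʳ-≤ 2 2≤m)) (≤-trans ≤4 4≤n)
  ... | no ≰4 = ⊓-glb (length≤-of-injective-bounded uX code (2 * m) (code-injective 2≤m) (λ _ → code<2m))
                      (length≤-of-injective-bounded uX (toℕ ∘ col) n (λ x∈X y∈X x≢y → cols-distinct x∈X y∈X x≢y ∘ toℕ-injective)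
                                                    (λ {x} _ → toℕ<n (col x)))
    where open EvenCycle uX h n≡2h (≰⇒> ≰4)

module TwoFaultTolerant (m n : ℕ) (3≤n : 3 ≤ n) {k : ℕ} {X : List (Fin m × Fin n)}
                        (ft : IsFTMV (PmCn m n) k X) (2≤k : 2 ≤ k) (4≤n : 4 ≤ n) where
  open Grid m n 3≤n
  open FreeSteps m n 3≤n ft

  record FarApart (u v : V) : Set where
    field
      cols-antipodal : Antipodal (col u) (col v)
      rows-differ : 0 < ∣ row u - row v ∣
      vertical-step∉X : ∀ {z} → VerticalStep u v z → z ∉ X

  one-vertical⇒farApart : ∀ {u v a b c} → VerticalStep u v a → HorizontalStep u v b → HorizontalStep u v c →
                          b ≢ c → a ∉ X → FarApart u v
  one-vertical⇒farApart va hb hc b≢c a∉X = record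
    { cols-antipodal = distinct-horizontalSteps⇒antipodal hb hc b≢c
    ; rows-differ = ≤-<-trans z≤n (VerticalStep.closer va)
    ; vertical-step∉X = λ vz z∈X → a∉X (subst (_∈ X) (verticalStep-unique vz va) z∈X)
    }

  -- Among three distinct steps toward v at most one is vertical and at most two are horizontal.
  three-free-steps⇒farApart : ∀ {u v x₀ x₁ x₂} → StepToward u v x₀ → StepToward u v x₁ → StepToward u v x₂ →
                              x₀ ∉ X → x₁ ∉ X → x₂ ∉ X → x₀ ≢ x₁ → x₀ ≢ x₂ → x₁ ≢ x₂ → FarApart u v
  three-free-steps⇒farApart s₀ s₁ s₂ x₀∉X x₁∉X x₂∉X x₀≢x₁ x₀≢x₂ x₁≢x₂
    with step⇒vertical⊎horizontal s₀ | step⇒vertical⊎horizontal s₁ | step⇒vertical⊎horizontal s₂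
  ... | inj₁ a | inj₁ b | _ = ⊥-elim (x₀≢x₁ (verticalStep-unique a b))
  ... | inj₁ a | inj₂ _ | inj₁ c = ⊥-elim (x₀≢x₂ (verticalStep-unique a c))
  ... | inj₂ _ | inj₁ b | inj₁ c = ⊥-elim (x₁≢x₂ (verticalStep-unique b c))
  ... | inj₁ a | inj₂ b | inj₂ c = one-vertical⇒farApart a b c x₁≢x₂ x₀∉X
  ... | inj₂ a | inj₁ b | inj₂ c = one-vertical⇒farApart b a c x₀≢x₂ x₁∉X
  ... | inj₂ a | inj₂ b | inj₁ c = one-vertical⇒farApart c a b x₀≢x₁ x₂∉X
  ... | inj₂ a | inj₂ b | inj₂ c = ⊥-elim (no-three-horizontalSteps a b c x₀≢x₁ x₀≢x₂ x₁≢x₂)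

  nonadjacent⇒farApart : ∀ {u v} → u ∈ X → v ∈ X → u ≢ v → ¬ Adj u v → FarApart u v
  nonadjacent⇒farApart u∈X v∈X u≢v ¬adj =
    three-free-steps⇒farApart (toward i₀) (toward i₁) (toward i₂) (∉X i₀) (∉X i₁) (∉X i₂)
      (injective (fromℕ<-≢ z<s 1<k+1 0≢1+n)) (injective (fromℕ<-≢ z<s 2<k+1 0≢1+n))
      (injective (fromℕ<-≢ 1<k+1 2<k+1 (1+n≢n ∘ sym)))
    where
    1<k+1 : 1 < suc k
    1<k+1 = s≤s (≤-trans (s≤s z≤n) 2≤k)
    2<k+1 : 2 < suc k
    2<k+1 = s≤s 2≤k
    i₀ i₁ i₂ : Fin (suc k)
    i₀ = fromℕ< z<s
    i₁ = fromℕ< 1<k+1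
    i₂ = fromℕ< 2<k+1
    toward = free-step-toward u∈X v∈X u≢v ¬adj
    ∉X = free-step∉X u∈X v∈X u≢v ¬adj
    injective = free-step-injective u∈X v∈X u≢v ¬adj

  farApart⇒3≤dist : ∀ {u v} → FarApart u v → 3 ≤ dist u v
  farApart⇒3≤dist {u} {v} far = +-mono-≤ (FarApart.rows-differ far)
    (subst (2 ≤_) (sym (antipodal⇒cycDist≡offset (FarApart.cols-antipodal far))) 2≤offset)
    where
    2≤offset : 2 ≤ offset (col u) (col v)
    2≤offset with offset (col u) (col v) ≤? 1
    ... | no ≰1 = ≰⇒> ≰1
    ... | yes ≤1 = ⊥-elim (<⇒≱ (≤-trans (s≤s (s≤s (s≤s z≤n))) 4≤n)
                      (subst (_≤ 2) (Antipodal.double-offset≡n (FarApart.cols-antipodal far)) (+-mono-≤ ≤1 ≤1)))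

  -- Both would lie in the column opposite col v, so their edge is vertical and one is a vertical step from the other.
  farApart-neighbours : ∀ {u v w} → u ∈ X → w ∈ X → FarApart u v → FarApart w v → Adj u w → u ≢ w → ⊥
  farApart-neighbours {u} {v} {w} u∈X w∈X far-u far-w uw u≢w = neighbours (adjacent-cases uw)
    where
    same-col : col u ≡ col w
    same-col = antipodal-uniqueˡ (FarApart.cols-antipodal far-u) (FarApart.cols-antipodal far-w)
    neighbours : AdjacentBy u w → ⊥
    neighbours (inj₁ (r , _)) = u≢w (×-≡,≡→≡ (r , same-col))
    neighbours (inj₂ (_ , u~w)) =
      [ (λ w-closer → FarApart.vertical-step∉X far-u (vertical (sym same-col) u~w w-closer) w∈X) ,
        (λ u-closer → FarApart.vertical-step∉X far-w (vertical same-col (consecutive-sym u~w) u-closer) u∈X) ]′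
        (consecutive⇒∣-∣-distinct u~w (row v))

  nonadjacent-pair⇒no-third : ∀ {u v w} → u ∈ X → v ∈ X → w ∈ X → u ≢ v → u ≢ w → v ≢ w → ¬ Adj u v → ⊥
  nonadjacent-pair⇒no-third {u} {v} {w} u∈X v∈X w∈X u≢v u≢w v≢w ¬uv with adjacent? u w | adjacent? v w
  ... | yes uw | yes vw = <⇒≱ (<-≤-trans (n<1+n 2) (farApart⇒3≤dist (nonadjacent⇒farApart u∈X v∈X u≢v ¬uv)))
                             (dist≤length (uw ∷ (Adj-sym vw ∷ [])))
  ... | yes uw | no ¬vw = farApart-neighbours u∈X w∈X (nonadjacent⇒farApart u∈X v∈X u≢v ¬uv)
                            (nonadjacent⇒farApart w∈X v∈X (≢-sym v≢w) (¬vw ∘ Adj-sym)) uw u≢w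
  ... | no ¬uw | yes vw = farApart-neighbours v∈X w∈X (nonadjacent⇒farApart v∈X u∈X (≢-sym u≢v) (¬uv ∘ Adj-sym))
                            (nonadjacent⇒farApart w∈X u∈X (≢-sym u≢w) (¬uw ∘ Adj-sym)) vw v≢w
  ... | no ¬uw | no ¬vw =
    antipodal⇒≢ (subst (λ c → Antipodal c (col v)) same-col (FarApart.cols-antipodal (nonadjacent⇒farApart u∈X v∈X u≢v ¬uv))) refl
    where
    same-col : col u ≡ col v
    same-col = antipodal-uniqueˡ (FarApart.cols-antipodal (nonadjacent⇒farApart u∈X w∈X u≢w ¬uw))
                                 (FarApart.cols-antipodal (nonadjacent⇒farApart v∈X w∈X v≢w ¬vw))

  length≤2 : Unique X → length X ≤ 2
  length≤2 uX with length X ≤? 2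
  ... | yes ≤2 = ≤2
  ... | no ≰2 with fresh uX [] (≤-trans (s≤s z≤n) (≰⇒> ≰2))
  ... | a , a∈X , [] with fresh uX (a ∷ []) (≤-trans (s≤s (s≤s z≤n)) (≰⇒> ≰2))
  ... | b , b∈X , b≢a ∷ [] with fresh uX (a ∷ b ∷ []) (≰⇒> ≰2)
  ... | c , c∈X , c≢a ∷ c≢b ∷ [] with adjacent? a b | adjacent? a c | adjacent? b c
  ... | no ¬ab | _ | _ = ⊥-elim (nonadjacent-pair⇒no-third a∈X b∈X c∈X (≢-sym b≢a) (≢-sym c≢a) (≢-sym c≢b) ¬ab)
  ... | yes _ | no ¬ac | _ = ⊥-elim (nonadjacent-pair⇒no-third a∈X c∈X b∈X (≢-sym c≢a) (≢-sym b≢a) c≢b ¬ac)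
  ... | yes _ | yes _ | no ¬bc = ⊥-elim (nonadjacent-pair⇒no-third b∈X c∈X a∈X (≢-sym c≢b) b≢a c≢a ¬bc)
  ... | yes ab | yes ac | yes bc = ⊥-elim (no-triangle 4≤n ab ac bc (≢-sym c≢b))

-- Constructions

module Constructions (m n : ℕ) (3≤n : 3 ≤ n) where
  open Grid m n 3≤n

  vertex : ∀ i j → i < m → j < n → V
  vertex i j i<m j<n = fromℕ< i<m , fromℕ< j<n

  below⇒All≢ : ∀ {x xs} → (∀ {y} → y ∈ xs → row y < row x) → All (x ≢_) xs
  below⇒All≢ below = All.tabulate λ y∈xs x≡y → <⇒≢ (below y∈xs) (cong row (sym x≡y))

  diagonal : ∀ q → q ≤ m → q ≤ n → List V
  diagonal zero _ _ = []
  diagonal (suc q) q<m q<n = vertex q q q<m q<n ∷ diagonal q (<⇒≤ q<m) (<⇒≤ q<n)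

  ∈-diagonal : ∀ {q q≤m q≤n x} → x ∈ diagonal q q≤m q≤n → row x ≡ toℕ (col x) × row x < q
  ∈-diagonal {suc q} {q<m} {q<n} (here refl) = trans (toℕ-fromℕ< q<m) (sym (toℕ-fromℕ< q<n)) ,
                                                subst (_< suc q) (sym (toℕ-fromℕ< q<m)) (n<1+n q)
  ∈-diagonal {suc q} (there x∈) = let (diag , x<q) = ∈-diagonal x∈ in diag , m<n⇒m<1+n x<q

  length-diagonal : ∀ q q≤m q≤n → length (diagonal q q≤m q≤n) ≡ q
  length-diagonal zero _ _ = refl
  length-diagonal (suc q) _ _ = cong suc (length-diagonal q _ _)

  diagonal-unique : ∀ q q≤m q≤n → Unique (diagonal q q≤m q≤n)
  diagonal-unique zero _ _ = []
  diagonal-unique (suc q) q<m q<n =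
    below⇒All≢ (λ y∈ → subst (_ <_) (sym (toℕ-fromℕ< q<m)) (proj₂ (∈-diagonal y∈))) ∷ diagonal-unique q _ _

  diagonal-ftmv : ∀ q q≤m q≤n → IsFTMV 𝔾 1 (diagonal q q≤m q≤n)
  diagonal-ftmv q q≤m q≤n (g , h) (g' , h') u∈X v∈X u≢v _ = lShaped-disjointGeodesics g g' h h' (rows≢ ∘ cong toℕ) cols≢ avoid₁ avoid₂
    where
    X = diagonal q q≤m q≤n
    diag : ∀ {x} → x ∈ X → row x ≡ toℕ (col x)
    diag x∈X = proj₁ (∈-diagonal x∈X)
    rows≢ : toℕ g ≢ toℕ g'
    rows≢ e = u≢v (×-≡,≡→≡ (toℕ-injective e , toℕ-injective (trans (sym (diag u∈X)) (trans e (diag v∈X)))))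
    cols≢ : h ≢ h'
    cols≢ e = rows≢ (trans (diag u∈X) (trans (cong toℕ e) (sym (diag v∈X))))
    avoid₁ : ∀ x → RowFirst g g' h h' x → x ∉ X
    avoid₁ x (inj₁ (r , arc)) x∈X = proj₁ (shortArc-interior arc) (toℕ-injective (trans (sym (diag x∈X)) (trans (cong toℕ r) (diag u∈X))))
    avoid₁ x (inj₂ (inj₁ refl)) x∈X = rows≢ (trans (diag x∈X) (sym (diag v∈X)))
    avoid₁ x (inj₂ (inj₂ (c , btw))) x∈X = proj₂ (between⇒≢ btw) (trans (diag x∈X) (trans (cong toℕ c) (sym (diag v∈X))))
    avoid₂ : ∀ x → ColumnFirst g g' h h' x → x ∉ X
    avoid₂ x (inj₁ (c , btw)) x∈X = proj₁ (between⇒≢ btw) (trans (diag x∈X) (trans (cong toℕ c) (sym (diag u∈X))))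
    avoid₂ x (inj₂ (inj₁ refl)) x∈X = rows≢ (sym (trans (diag x∈X) (sym (diag u∈X))))
    avoid₂ x (inj₂ (inj₂ (r , arc))) x∈X =
      proj₁ (proj₂ (shortArc-interior arc)) (toℕ-injective (trans (sym (diag x∈X)) (trans (cong toℕ r) (diag v∈X))))

  module EvenConstruction (h : ℕ) (n≡2h : n ≡ h + h) where

    InClass : ℕ → ℕ → Set
    InClass a y = y ≡ a ⊎ y ≡ a + h

    0<h : 0 < h
    0<h = n≢0⇒n>0 (λ h≡0 → <⇒≢ (≤-trans (s≤s z≤n) 3≤n) (sym (trans n≡2h (cong₂ _+_ h≡0 h≡0))))

    h<n : h < n
    h<n = subst (h <_) (sym n≡2h) (m<m+n h 0<h)

    i<n : ∀ {i} → i < h → i < n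
    i<n i<h = <-≤-trans i<h (<⇒≤ h<n)

    i+h<n : ∀ {i} → i < h → i + h < n
    i+h<n {i} i<h = subst (i + h <_) (sym n≡2h) (+-monoˡ-< h i<h)

    pairs : ∀ q → q ≤ m → q ≤ h → List V
    pairs zero _ _ = []
    pairs (suc i) i<m i<h = vertex i i i<m (i<n i<h) ∷ vertex i (i + h) i<m (i+h<n i<h) ∷ pairs i (<⇒≤ i<m) (<⇒≤ i<h)

    ∈-pairs : ∀ {q q≤m q≤h x} → x ∈ pairs q q≤m q≤h → row x < q × InClass (row x) (toℕ (col x))
    ∈-pairs {suc i} {i<m} {i<h} (here refl) =
      subst (_< suc i) (sym (toℕ-fromℕ< i<m)) (n<1+n i) , inj₁ (trans (toℕ-fromℕ< (i<n i<h)) (sym (toℕ-fromℕ< i<m)))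
    ∈-pairs {suc i} {i<m} {i<h} (there (here refl)) =
      subst (_< suc i) (sym (toℕ-fromℕ< i<m)) (n<1+n i) ,
      inj₂ (trans (toℕ-fromℕ< (i+h<n i<h)) (cong (_+ h) (sym (toℕ-fromℕ< i<m))))
    ∈-pairs {suc i} (there (there x∈)) = let (x<i , cls) = ∈-pairs x∈ in m<n⇒m<1+n x<i , cls

    length-pairs : ∀ q q≤m q≤h → length (pairs q q≤m q≤h) ≡ q + q
    length-pairs zero _ _ = refl
    length-pairs (suc q) _ _ = cong suc (trans (cong suc (length-pairs q _ _)) (sym (+-suc q q)))

    pairs-unique : ∀ q q≤m q≤h → Unique (pairs q q≤m q≤h)
    pairs-unique zero _ _ = []
    pairs-unique (suc i) i<m i<h = (cols≢ ∷ below (toℕ-fromℕ< i<m)) ∷ below (toℕ-fromℕ< i<m) ∷ pairs-unique i _ _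
      where
      below : ∀ {w} → row w ≡ i → All (w ≢_) (pairs i (<⇒≤ i<m) (<⇒≤ i<h))
      below r = below⇒All≢ (λ y∈ → subst (_ <_) (sym r) (proj₁ (∈-pairs y∈)))
      cols≢ : vertex i i i<m (i<n i<h) ≢ vertex i (i + h) i<m (i+h<n i<h)
      cols≢ e = <⇒≢ (m<m+n i 0<h) (trans (sym (toℕ-fromℕ< (i<n i<h))) (trans (cong (toℕ ∘ col) e) (toℕ-fromℕ< (i+h<n i<h))))

    InClass-unique : ∀ {a a' y} → InClass a y → InClass a' y → a < h → a' < h → a ≡ a'
    InClass-unique (inj₁ p) (inj₁ q) _ _ = trans (sym p) q
    InClass-unique (inj₂ p) (inj₂ q) _ _ = +-cancelʳ-≡ h _ _ (trans (sym p) q)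
    InClass-unique {a' = a'} (inj₁ p) (inj₂ q) a<h _ = ⊥-elim (<⇒≱ a<h (subst (h ≤_) (trans (sym q) p) (m≤n+m h a')))
    InClass-unique {a} (inj₂ p) (inj₁ q) _ a'<h = ⊥-elim (<⇒≱ a'<h (subst (h ≤_) (trans (sym p) q) (m≤n+m h a)))

    InClass⇒≡⊎antipodal : ∀ {a} {y b : Fin n} → InClass a (toℕ y) → InClass a (toℕ b) → y ≡ b ⊎ Antipodal b y
    InClass⇒≡⊎antipodal (inj₁ p) (inj₁ q) = inj₁ (toℕ-injective (trans p (sym q)))
    InClass⇒≡⊎antipodal (inj₂ p) (inj₂ q) = inj₁ (toℕ-injective (trans p (sym q)))
    InClass⇒≡⊎antipodal {a} {y} {b} (inj₁ p) (inj₂ q) = inj₂ (offset≡half⇒antipodal n≡2h (offset-unique b y h<n (inj₂ wraps)))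
      where
      wraps : toℕ b + h ≡ toℕ y + n
      wraps = trans (cong (_+ h) q) (trans (+-assoc a h h) (trans (cong (a +_) (sym n≡2h)) (cong (_+ n) (sym p))))
    InClass⇒≡⊎antipodal {a} {y} {b} (inj₂ p) (inj₁ q) =
      inj₂ (offset≡half⇒antipodal n≡2h (offset-unique b y h<n (inj₁ (trans (cong (_+ h) q) (sym p)))))

    module _ {q : ℕ} {q≤m : q ≤ m} {q≤h : q ≤ h} where
      private
        X = pairs q q≤m q≤h

        row<h : ∀ {x} → x ∈ X → row x < h
        row<h x∈X = <-≤-trans (proj₁ (∈-pairs x∈X)) q≤h

        class : ∀ {x} → x ∈ X → InClass (row x) (toℕ (col x))
        class x∈X = proj₂ (∈-pairs x∈X)

      pairs-same-row : ∀ {g c₁ c₂} → (g , c₁) ∈ X → (g , c₂) ∈ X → c₁ ≢ c₂ → DisjointGeodesics 1 X (g , c₁) (g , c₂)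
      pairs-same-row {g} {c₁} {c₂} u∈X v∈X c₁≢c₂ = antipodal-in-row-disjointGeodesics g c₁-c₂ in-row
        where
        in-row : ∀ y → (g , y) ∈ X → y ≡ c₁ ⊎ Antipodal c₁ y
        in-row y y∈X = InClass⇒≡⊎antipodal (class y∈X) (class u∈X)
        c₁-c₂ : Antipodal c₁ c₂
        c₁-c₂ = [ (λ c₂≡c₁ → ⊥-elim (c₁≢c₂ (sym c₂≡c₁))) , (λ a → a) ]′ (in-row c₂ v∈X)

      pairs-different-rows : ∀ {g g' c₁ c₂} → (g , c₁) ∈ X → (g' , c₂) ∈ X → toℕ g ≢ toℕ g' →
                             DisjointGeodesics 1 X (g , c₁) (g' , c₂)
      pairs-different-rows {g} {g'} {c₁} {c₂} u∈X v∈X rows≢ =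
        lShaped-disjointGeodesics g g' c₁ c₂ (rows≢ ∘ cong toℕ) cols≢ avoid₁ avoid₂
        where
        same-class⇒same-row : ∀ {x y} → x ∈ X → y ∈ X → col x ≡ col y → row x ≡ row y
        same-class⇒same-row x∈X y∈X c = InClass-unique (subst (InClass _ ∘ toℕ) c (class x∈X)) (class y∈X) (row<h x∈X) (row<h y∈X)
        cols≢ : c₁ ≢ c₂
        cols≢ c = rows≢ (same-class⇒same-row u∈X v∈X c)
        in-row : ∀ {x} → proj₁ x ≡ g → x ∈ X → col x ≡ c₁ ⊎ Antipodal c₁ (col x)
        in-row r x∈X = InClass⇒≡⊎antipodal (class (subst (_∈ X) (×-≡,≡→≡ (r , refl)) x∈X)) (class u∈X)
        in-row' : ∀ {x} → proj₁ x ≡ g' → x ∈ X → col x ≡ c₂ ⊎ Antipodal c₂ (col x)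
        in-row' r x∈X = InClass⇒≡⊎antipodal (class (subst (_∈ X) (×-≡,≡→≡ (r , refl)) x∈X)) (class v∈X)
        avoid₁ : ∀ x → RowFirst g g' c₁ c₂ x → x ∉ X
        avoid₁ x (inj₁ (r , arc)) x∈X = let (≢c₁ , _ , ¬a , _) = shortArc-interior arc in [ ≢c₁ , ¬a ]′ (in-row r x∈X)
        avoid₁ x (inj₂ (inj₁ refl)) x∈X = rows≢ (same-class⇒same-row x∈X v∈X refl)
        avoid₁ x (inj₂ (inj₂ (c , btw))) x∈X = proj₂ (between⇒≢ btw) (same-class⇒same-row x∈X v∈X c)
        avoid₂ : ∀ x → ColumnFirst g g' c₁ c₂ x → x ∉ X
        avoid₂ x (inj₁ (c , btw)) x∈X = proj₁ (between⇒≢ btw) (same-class⇒same-row x∈X u∈X c)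
        avoid₂ x (inj₂ (inj₁ refl)) x∈X = rows≢ (sym (same-class⇒same-row x∈X u∈X refl))
        avoid₂ x (inj₂ (inj₂ (r , arc))) x∈X = let (_ , ≢c₂ , _ , ¬a) = shortArc-interior arc in [ ≢c₂ , ¬a ]′ (in-row' r x∈X)

    pairs-ftmv : ∀ q q≤m q≤h → IsFTMV 𝔾 1 (pairs q q≤m q≤h)
    pairs-ftmv q q≤m q≤h (g , c₁) (g' , c₂) u∈X v∈X u≢v _ with toℕ g ≟ toℕ g'
    ... | no rows≢ = pairs-different-rows u∈X v∈X rows≢
    ... | yes rows≡ with toℕ-injective rows≡
    ... | refl = pairs-same-row u∈X v∈X (λ { refl → u≢v refl })

-- The case m = 2 and n = 2j + 1 with j = i + 2.
module OddTwoRows (i : ℕ) where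
  private
    j = suc (suc i)
    n = suc (j + j)

    3≤n : 3 ≤ n
    3≤n = s≤s (s≤s (s≤s z≤n))

  open Grid 2 n 3≤n

  private
    1+j<n : suc j < n
    1+j<n = s≤s (s≤s (s≤s (m<m+n i z<s)))

  top bottom : Fin 2
  top = fzero
  bottom = fsuc fzero

  c₀ c₁ c' : Fin n
  c₀ = fzero
  c₁ = fsuc fzero
  c' = fromℕ< 1+j<n

  -- Two adjacent vertices of the top row and the vertex of the bottom row opposite their edge.
  S : List V
  S = (top , c₀) ∷ (top , c₁) ∷ (bottom , c') ∷ []

  private
    offset-of : ∀ {b e : Fin n} t → toℕ b + t ≡ toℕ e ⊎ toℕ b + t ≡ toℕ e + n → t < n → offset b e ≡ t
    offset-of {b} {e} t isOffset t<n = offset-unique b e t<n isOffset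

    j<n : j < n
    j<n = <-trans (n<1+n j) 1+j<n

    c₀c'≡1+j : offset c₀ c' ≡ suc j
    c₀c'≡1+j = offset-of (suc j) (inj₁ (sym (toℕ-fromℕ< 1+j<n))) 1+j<n
    c'c₀≡j : offset c' c₀ ≡ j
    c'c₀≡j = offset-of j (inj₂ (cong (_+ j) (toℕ-fromℕ< 1+j<n))) j<n
    c'c₁≡1+j : offset c' c₁ ≡ suc j
    c'c₁≡1+j = offset-of (suc j) (inj₂ (trans (cong (_+ suc j) (toℕ-fromℕ< 1+j<n)) (cong suc (+-suc j j)))) 1+j<n
    c₁c'≡j : offset c₁ c' ≡ j
    c₁c'≡j = offset-of j (inj₁ (sym (toℕ-fromℕ< 1+j<n))) j<n
    c₁c₀≡j+j : offset c₁ c₀ ≡ j + j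
    c₁c₀≡j+j = offset-of (j + j) (inj₂ refl) (n<1+n (j + j))

    1+j-not-short : ¬ (suc j + suc j ≤ n)
    1+j-not-short le = <⇒≱ (n<1+n n) (subst (_≤ n) (cong suc (+-suc j j)) le)

    ¬shortArc-c₀c'c₁ : ¬ ShortArc c₀ c' c₁
    ¬shortArc-c₀c'c₁ (inj₁ (_ , _ , short)) = 1+j-not-short (subst (λ t → t + t ≤ n) c₀c'≡1+j short)
    ¬shortArc-c₀c'c₁ (inj₂ (_ , inside , _)) = <⇒≱ (subst₂ _<_ c'c₁≡1+j c'c₀≡j inside) (n≤1+n j)

    ¬shortArc-c₁c'c₀ : ¬ ShortArc c₁ c' c₀
    ¬shortArc-c₁c'c₀ (inj₁ (_ , inside , _)) = <⇒≱ (subst₂ _<_ c₁c₀≡j+j c₁c'≡j inside) (m≤m+n j j)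
    ¬shortArc-c₁c'c₀ (inj₂ (_ , _ , short)) = 1+j-not-short (subst (λ t → t + t ≤ n) c'c₁≡1+j short)

    ¬between-rows : ∀ {x} → ¬ Between 0 1 x
    ¬between-rows (inj₁ (0<x , s≤s x≤0)) = <⇒≱ 0<x x≤0

    c₀≢c' : c₀ ≢ c'
    c₀≢c' e = 0≢1+n (trans (cong toℕ e) (toℕ-fromℕ< 1+j<n))
    c₁≢c' : c₁ ≢ c'
    c₁≢c' e = <⇒≢ (s≤s (s≤s z≤n)) (trans (cong toℕ e) (toℕ-fromℕ< 1+j<n))
    c₀≢c₁ : c₀ ≢ c₁
    c₀≢c₁ ()

    top-to-bottom : ∀ {c d} → (∀ {x} → x ∈ S → x ≡ (top , c) ⊎ x ≡ (top , d) ⊎ x ≡ (bottom , c')) →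
                    c ≢ c' → d ≢ c' → ¬ ShortArc c c' d → DisjointGeodesics 1 S (top , c) (bottom , c')
    top-to-bottom {c} {d} ∈S c≢c' d≢c' ¬short = lShaped-disjointGeodesics top bottom c c' (λ ()) c≢c' avoid₁ avoid₂
      where
      avoid₁ : ∀ x → RowFirst top bottom c c' x → x ∉ S
      avoid₁ x (inj₁ (r , arc)) x∈S with ∈S x∈S
      ... | inj₁ refl = proj₁ (shortArc-interior arc) refl
      ... | inj₂ (inj₁ refl) = ¬short arc
      ... | inj₂ (inj₂ refl) = case r of λ ()
      avoid₁ x (inj₂ (inj₁ refl)) x∈S with ∈S x∈S
      ... | inj₁ e = c≢c' (sym (cong proj₂ e))
      ... | inj₂ (inj₁ e) = d≢c' (sym (cong proj₂ e))
      ... | inj₂ (inj₂ e) = case cong proj₁ e of λ ()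
      avoid₁ x (inj₂ (inj₂ (_ , btw))) _ = ¬between-rows btw
      avoid₂ : ∀ x → ColumnFirst top bottom c c' x → x ∉ S
      avoid₂ x (inj₁ (_ , btw)) _ = ¬between-rows btw
      avoid₂ x (inj₂ (inj₁ refl)) x∈S with ∈S x∈S
      ... | inj₁ e = case cong proj₁ e of λ ()
      ... | inj₂ (inj₁ e) = case cong proj₁ e of λ ()
      ... | inj₂ (inj₂ e) = c≢c' (cong proj₂ e)
      avoid₂ x (inj₂ (inj₂ (r , arc))) x∈S with ∈S x∈S
      ... | inj₁ refl = case r of λ ()
      ... | inj₂ (inj₁ refl) = case r of λ ()
      ... | inj₂ (inj₂ refl) = proj₁ (proj₂ (shortArc-interior arc)) refl

    ∈S-from-c₀ : ∀ {x} → x ∈ S → x ≡ (top , c₀) ⊎ x ≡ (top , c₁) ⊎ x ≡ (bottom , c')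
    ∈S-from-c₀ (here refl) = inj₁ refl
    ∈S-from-c₀ (there (here refl)) = inj₂ (inj₁ refl)
    ∈S-from-c₀ (there (there (here refl))) = inj₂ (inj₂ refl)

    ∈S-from-c₁ : ∀ {x} → x ∈ S → x ≡ (top , c₁) ⊎ x ≡ (top , c₀) ⊎ x ≡ (bottom , c')
    ∈S-from-c₁ x∈S = [ inj₂ ∘ inj₁ , [ inj₁ , inj₂ ∘ inj₂ ]′ ]′ (∈S-from-c₀ x∈S)

    top-edge : Adj (top , c₀) (top , c₁)
    top-edge = inj₁ (refl , inj₁ refl)

  S-ftmv : IsFTMV 𝔾 1 S
  S-ftmv _ _ (here refl) (here refl) u≢v _ = ⊥-elim (u≢v refl)
  S-ftmv _ _ (here refl) (there (here refl)) _ ¬adj = ⊥-elim (¬adj top-edge)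
  S-ftmv _ _ (here refl) (there (there (here refl))) _ _ = top-to-bottom ∈S-from-c₀ c₀≢c' c₁≢c' ¬shortArc-c₀c'c₁
  S-ftmv _ _ (there (here refl)) (here refl) _ ¬adj = ⊥-elim (¬adj (Adj-sym top-edge))
  S-ftmv _ _ (there (here refl)) (there (here refl)) u≢v _ = ⊥-elim (u≢v refl)
  S-ftmv _ _ (there (here refl)) (there (there (here refl))) _ _ = top-to-bottom ∈S-from-c₁ c₁≢c' c₀≢c' ¬shortArc-c₁c'c₀
  S-ftmv _ _ (there (there (here refl))) (here refl) _ _ =
    DisjointGeodesics-sym (top-to-bottom ∈S-from-c₀ c₀≢c' c₁≢c' ¬shortArc-c₀c'c₁)
  S-ftmv _ _ (there (there (here refl))) (there (here refl)) _ _ =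
    DisjointGeodesics-sym (top-to-bottom ∈S-from-c₁ c₁≢c' c₀≢c' ¬shortArc-c₁c'c₀)
  S-ftmv _ _ (there (there (here refl))) (there (there (here refl))) u≢v _ = ⊥-elim (u≢v refl)

  S-unique : Unique S
  S-unique = ((c₀≢c₁ ∘ cong proj₂) ∷ (λ ()) ∷ []) ∷ ((λ ()) ∷ []) ∷ [] ∷ []

module _ (m n : ℕ) where

  row-edge : List (Fin (suc m) × Fin (suc (suc n)))
  row-edge = (fzero , fzero) ∷ (fzero , fsuc fzero) ∷ []

  row-edge-unique : Unique row-edge
  row-edge-unique = ((λ ()) ∷ []) ∷ [] ∷ []

  row-edge-ftmv : ∀ k → IsFTMV (PmCn (suc m) (suc (suc n))) k row-edge
  row-edge-ftmv k = clique⇒ftmv (PmCn (suc m) (suc (suc n))) k adjacent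
    where
    adjacent : ∀ {u v} → u ∈ row-edge → v ∈ row-edge → u ≢ v → Graph.Adj (PmCn (suc m) (suc (suc n))) u v
    adjacent (here refl) (here refl) u≢v = ⊥-elim (u≢v refl)
    adjacent (here refl) (there (here refl)) _ = inj₁ (refl , inj₁ refl)
    adjacent (there (here refl)) (here refl) _ = inj₁ (refl , inj₂ (inj₁ refl))
    adjacent (there (here refl)) (there (here refl)) u≢v = ⊥-elim (u≢v refl)

module _ (m : ℕ) where

  row-triangle : List (Fin (suc m) × Fin 3)
  row-triangle = (fzero , fzero) ∷ (fzero , fsuc fzero) ∷ (fzero , fsuc (fsuc fzero)) ∷ []

  row-triangle-unique : Unique row-triangle
  row-triangle-unique = ((λ ()) ∷ (λ ()) ∷ []) ∷ ((λ ()) ∷ []) ∷ [] ∷ []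

  row-triangle-ftmv : ∀ k → IsFTMV (PmCn (suc m) 3) k row-triangle
  row-triangle-ftmv k = clique⇒ftmv (PmCn (suc m) 3) k adjacent
    where
    adjacent : ∀ {u v} → u ∈ row-triangle → v ∈ row-triangle → u ≢ v → Graph.Adj (PmCn (suc m) 3) u v
    adjacent (here refl) (here refl) u≢v = ⊥-elim (u≢v refl)
    adjacent (here refl) (there (here refl)) _ = inj₁ (refl , inj₁ refl)
    adjacent (here refl) (there (there (here refl))) _ = inj₁ (refl , inj₂ (inj₂ (inj₁ (refl , refl))))
    adjacent (there (here refl)) (here refl) _ = inj₁ (refl , inj₂ (inj₁ refl))
    adjacent (there (here refl)) (there (here refl)) u≢v = ⊥-elim (u≢v refl)
    adjacent (there (here refl)) (there (there (here refl))) _ = inj₁ (refl , inj₁ refl)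
    adjacent (there (there (here refl))) (here refl) _ = inj₁ (refl , inj₂ (inj₂ (inj₂ (refl , refl))))
    adjacent (there (there (here refl))) (there (here refl)) _ = inj₁ (refl , inj₂ (inj₁ refl))
    adjacent (there (there (here refl))) (there (there (here refl))) u≢v = ⊥-elim (u≢v refl)

fμ-triangle : ∀ m k → 2 ≤ m → 1 ≤ k → IsFμ (PmCn m 3) k 3
fμ-triangle (suc m) k _ 1≤k = lower , upper
  where
  lower : FTMVSetOfSize (PmCn (suc m) 3) k 3
  lower = row-triangle m , row-triangle-unique m , row-triangle-ftmv m k , refl
  upper : FTMVBound (PmCn (suc m) 3) k 3
  upper X uX ft = ≤-trans (FaultTolerant.NoAntipodes.length≤3⊔m⊓n (suc m) 3 ≤-refl ft 1≤k (Cycle.odd⇒¬antipodal 3 ≤-refl {1} refl) uX)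
                          (⊔-lub ≤-refl (m⊓n≤n (suc m) 3))

fμ-even : ∀ m n → 2 ≤ m → 4 ≤ n → Σ ℕ (λ h → n ≡ h + h) → IsFμ (PmCn m n) 1 ((2 * m) ⊓ n)
fμ-even m n 2≤m 4≤n (h , n≡2h) = lower , upper
  where
  3≤n = ≤-trans (n≤1+n 3) 4≤n
  open Constructions m n 3≤n
  open EvenConstruction h n≡2h
  q = m ⊓ h
  length≡ : q + q ≡ (2 * m) ⊓ n
  length≡ = begin
    q + q                  ≡⟨ cong (q +_) (+-identityʳ q) ⟨
    2 * q                  ≡⟨ *-distribˡ-⊓ 2 m h ⟩
    2 * m ⊓ (h + (h + 0))  ≡⟨ cong (λ z → 2 * m ⊓ (h + z)) (+-identityʳ h) ⟩
    2 * m ⊓ (h + h)        ≡⟨ cong (2 * m ⊓_) n≡2h ⟨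
    2 * m ⊓ n              ∎
    where open ≡-Reasoning
  lower : FTMVSetOfSize (PmCn m n) 1 ((2 * m) ⊓ n)
  lower = pairs q (m⊓n≤m m h) (m⊓n≤n m h) , pairs-unique q _ _ , pairs-ftmv q _ _ , trans (length-pairs q _ _) length≡
  upper : FTMVBound (PmCn m n) 1 ((2 * m) ⊓ n)
  upper X uX ft = FaultTolerant.length≤2m⊓n m n 3≤n ft ≤-refl uX h n≡2h 2≤m 4≤n

odd-set : ∀ m n → 2 ≤ m → 5 ≤ n → Σ ℕ (λ h → n ≡ suc (h + h)) → FTMVSetOfSize (PmCn m n) 1 (3 ⊔ (m ⊓ n))
odd-set 1 _ (s≤s ()) _ _
odd-set 2 _ _ _ (suc (suc i) , refl) = S , S-unique , S-ftmv , refl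
  where open OddTwoRows i
odd-set 2 _ _ (s≤s ()) (0 , refl)
odd-set 2 _ _ (s≤s (s≤s (s≤s ()))) (1 , refl)
odd-set m@(suc (suc (suc _))) n _ 5≤n _ =
  diagonal q (m⊓n≤m m n) (m⊓n≤n m n) , diagonal-unique q _ _ , diagonal-ftmv q _ _ ,
  trans (length-diagonal q _ _) (sym (m≤n⇒m⊔n≡n (⊓-glb (s≤s (s≤s (s≤s z≤n))) 3≤n)))
  where
  3≤n = ≤-trans (s≤s (s≤s (s≤s z≤n))) 5≤n
  open Constructions m n 3≤n
  q = m ⊓ n

fμ-odd : ∀ m n → 2 ≤ m → 5 ≤ n → Σ ℕ (λ h → n ≡ suc (h + h)) → IsFμ (PmCn m n) 1 (3 ⊔ (m ⊓ n))
fμ-odd m n 2≤m 5≤n (h , n≡2h+1) = odd-set m n 2≤m 5≤n (h , n≡2h+1) , upper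
  where
  upper : FTMVBound (PmCn m n) 1 (3 ⊔ (m ⊓ n))
  upper X uX ft = FaultTolerant.NoAntipodes.length≤3⊔m⊓n m n 3≤n ft ≤-refl (Cycle.odd⇒¬antipodal n 3≤n {h} n≡2h+1) uX
    where 3≤n = ≤-trans (s≤s (s≤s (s≤s z≤n))) 5≤n

fμ-2≤k : ∀ m n k → 2 ≤ m → 4 ≤ n → 2 ≤ k → IsFμ (PmCn m n) k 2
fμ-2≤k _ 1 _ _ (s≤s ()) _
fμ-2≤k (suc m) (suc (suc n)) k _ 4≤n 2≤k = (row-edge m n , row-edge-unique m n , row-edge-ftmv m n k , refl) , upper
  where
  upper : FTMVBound (PmCn (suc m) (suc (suc n))) k 2
  upper X uX ft = TwoFaultTolerant.length≤2 (suc m) (suc (suc n)) (≤-trans (n≤1+n 3) 4≤n) ft 2≤k 4≤n uX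

theorem6p3 : ∀ m n k → 2 ≤ m → 3 ≤ n →
    (1 ≤ k → n ≡ 3 → IsFμ (PmCn m n) k 3)
    × (k ≡ 1 → 4 ≤ n → 2 ∣ n → IsFμ (PmCn m n) k ((2 * m) ⊓ n))
    × (k ≡ 1 → 5 ≤ n → ¬ (2 ∣ n) → IsFμ (PmCn m n) k (3 ⊔ (m ⊓ n)))
    × (2 ≤ k → 4 ≤ n → IsFμ (PmCn m n) k 2)
theorem6p3 m n k 2≤m _ =
  (λ { 1≤k refl → fμ-triangle m k 2≤m 1≤k }) ,
  (λ { refl 4≤n 2∣n → fμ-even m n 2≤m 4≤n (2∣n⇒even 2∣n) }) ,
  (λ { refl 5≤n 2∤n → fμ-odd m n 2≤m 5≤n (¬2∣n⇒odd 2∤n) }) ,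
  (λ 2≤k 4≤n → fμ-2≤k m n k 2≤m 4≤n 2≤k)
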